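{- Let $n\geq 2$ and let $\gamma$ be an automorphism of the ordinary $n$-associahedron $\mathcal{A}_n$ (associated with a convex $(n+3)$-gon $N$ with vertices $1,\ldots,n+3$ in cyclic order). If $\gamma$ fixes two facets $F_j$ and $F_{j+1}$ (indices mod $n+3$) corresponding to adjacent vertices $j,j+1$ of $N$, then $\gamma$ is the identity.
   Context: The ordinary $n$-associahedron $\mathcal{A}_n$ is taken as an abstract polytope (its face lattice): vertices are the triangulations of the convex $(n+3)$-gon $N$; for $j=0,\ldots,n$ the $j$-faces correspond to sets of $n-j$ pairwise non-crossing diagonals of $N$, with vertex set all triangulations containing these diagonals; ordered by inclusion, with an added face of rank $-1$. For a vertex $j$ of $N$, $F_j$ denotes the facet of $\mathcal{A}_n$ whose vertices are the triangulations containing the diagonal $\{j-1,j+1\}$ (indices mod $n+3$). An automorphism is an order-preserving bijection of the face poset. -}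

module Defs where

open import Data.Nat as ℕ using (ℕ; zero; suc; _+_; _≤ᵇ_; _<ᵇ_; _≡ᵇ_; _%_)
open import Data.Nat using (_⊓_; _⊔_)
open import Data.Fin using (Fin; toℕ)
open import Data.Bool using (Bool; true; false; _∧_; _∨_; not; T)
open import Data.Vec using (Vec; lookup; tabulate)
open import Data.List using (List; []; _∷_; allFin)
open import Data.Product using (Σ; _×_; _,_)
open import Data.Sum using (_⊎_)
open import Data.Empty using (⊥)
open import Function.Bundles using (_⤖_; Bijection)
open import Relation.Binary.PropositionalEquality using (_≡_)

-- The convex polygon N has m = n + 3 vertices, labelled 0 , … , n+2 in cyclic
-- order (the paper's labels 1 , … , n+3 shifted by one).  We write 3 + n so
-- that it reduces to suc (suc (suc n)).
Vtx : ℕ → Set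
Vtx n = Fin (3 + n)

allB : ∀ {A : Set} → (A → Bool) → List A → Bool
allB p [] = true
allB p (x ∷ xs) = p x ∧ allB p xs

-- A diagonal {a,b} is stored as the ordered pair (a,b) with a < b.
-- (a,b) is a diagonal iff a+2 ≤ b and {a,b} ≠ {0, n+2} (non-adjacent vertices).
isDiag : ∀ n → Vtx n → Vtx n → Bool
isDiag n a b = (suc (suc (toℕ a)) ≤ᵇ toℕ b)
             ∧ not ((toℕ a ≡ᵇ 0) ∧ (toℕ b ≡ᵇ suc (suc n)))

crosses : ∀ n → (a b c d : Vtx n) → Bool
crosses n a b c d =
    ((toℕ a <ᵇ toℕ c) ∧ (toℕ c <ᵇ toℕ b) ∧ (toℕ b <ᵇ toℕ d))
  ∨ ((toℕ c <ᵇ toℕ a) ∧ (toℕ a <ᵇ toℕ d) ∧ (toℕ d <ᵇ toℕ b))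

-- A set of diagonals: a Boolean (3+n)×(3+n) matrix; entry (a,b) = true means
-- the diagonal (a,b) (with a < b) belongs to the set.
DiagSet : ℕ → Set
DiagSet n = Vec (Vec Bool (3 + n)) (3 + n)

mem : ∀ {n} → DiagSet n → Vtx n → Vtx n → Bool
mem S a b = lookup (lookup S a) b

validB : ∀ n → DiagSet n → Bool
validB n S =
    allB (λ a → allB (λ b → not (mem S a b) ∨ isDiag n a b) (allFin _)) (allFin _)
  ∧ allB (λ a → allB (λ b → allB (λ c → allB (λ d →
        not (mem S a b ∧ mem S c d) ∨ not (crosses n a b c d))
      (allFin _)) (allFin _)) (allFin _)) (allFin _)

-- Faces of the associahedron A_n: the added face of rank -1, and, for every set
-- S of pairwise non-crossing diagonals, the face determined by S
-- (of rank n - |S|).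
data Face (n : ℕ) : Set where
  bot  : Face n
  face : (S : DiagSet n) → T (validB n S) → Face n

_⊆D_ : ∀ {n} → DiagSet n → DiagSet n → Set
S ⊆D S' = ∀ a b → T (mem S a b) → T (mem S' a b)

IsTriangulation : ∀ n → DiagSet n → Set
IsTriangulation n S =
  T (validB n S) ×
  (∀ a b → T (isDiag n a b) →
     T (mem S a b) ⊎ Σ (Vtx n) (λ c → Σ (Vtx n) (λ d →
       T (mem S c d) × T (crosses n a b c d))))

VertexOf : ∀ {n} → DiagSet n → Face n → Set
VertexOf Tr bot = ⊥
VertexOf Tr (face S _) = S ⊆D Tr

_≤F_ : ∀ {n} → Face n → Face n → Set
_≤F_ {n} F G = ∀ Tr → IsTriangulation n Tr → VertexOf Tr F → VertexOf Tr G

record Automorphism (n : ℕ) : Set where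
  field
    bij  : Face n ⤖ Face n
  open Bijection bij public using (to)
  field
    mono : ∀ F G → F ≤F G → to F ≤F to G

open Automorphism public

facetSet : ∀ n → ℕ → DiagSet n
facetSet n k = tabulate λ a → tabulate λ b →
  (toℕ a ≡ᵇ (u ⊓ w)) ∧ (toℕ b ≡ᵇ (u ⊔ w))
  where
    u = (k + (2 + n)) % (3 + n)   -- k - 1 mod (3+n)
    w = (k + 1) % (3 + n)         -- k + 1 mod (3+n)

-- γ fixes the facet F_k (the face given by the single diagonal {k-1,k+1}).
FixesFacet : ∀ {n} → Automorphism n → ℕ → Set
FixesFacet {n} γ k =
  ∀ (p : T (validB n (facetSet n k))) → to γ (face (facetSet n k) p) ≡ face (facetSet n k) p

-- γ permutes the coatoms of the face poset, which are the facets, one for each diagonal. Faces are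
-- ordered by reverse inclusion of their sets of diagonals: a diagonal outside a dissection is avoided by
-- some triangulation containing the dissection (complete greedily, after flipping the diagonal if nothing
-- of the dissection crosses it). So the permutation σ of the diagonals induced by γ preserves
-- non-crossing, and, by counting non-crossing pairs, also crossing. The diagonals crossing the ear
-- {v , v + 2} are exactly those ending at v + 1; hence ear (v + 2) is the only diagonal t crossing
-- ear (v + 1) such that ear (v + 1) is the only diagonal crossing both ear v and t. The facets F_j and
-- F_(j+1) are the ears at j - 1 and j, so σ fixes all ears by induction around the polygon, then all
-- diagonals, each vertex being the tip of an ear; finally γ fixes every face, as a face is determined
-- by the facets above it and the triangulations below it.

module Submission where

open import Defs
open import Data.Nat as ℕ using (ℕ; zero; suc; _+_; _∸_; z≤n; s≤s; s≤s⁻¹; _%_; _⊓_; _⊔_; _<ᵇ_; _≡ᵇ_; _*_; _≤_)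
open import Data.Nat.Properties as ℕ using (+-assoc; +-comm; m<m+n; +-cancelˡ-≡; m+n∸n≡m; m∸n+n≡m; ∸-monoˡ-<; +-mono-<; ≮⇒≥; <-≤-trans; m+[n∸m]≡n; m≤n+m; ≤-trans; <⇒≤; <ᵇ⇒<; <⇒<ᵇ; ≤ᵇ⇒≤; ≤⇒≤ᵇ; ≡ᵇ⇒≡; ≡⇒≡ᵇ; 1+n≰n)
open import Data.Nat.DivMod using (m%n<n; n%n≡0; m<n⇒m%n≡m; %-distribˡ-+; m%n%n≡m%n; [m+n]%n≡m%n; m≤n⇒[n∸m]%m≡n%m)
open import Data.Fin using (Fin; toℕ; fromℕ<; _<_; _<?_; _≟_; punchOut)
open import Data.Fin.Properties using (toℕ-fromℕ<; toℕ-injective; toℕ<n; <-trans; <-asym; <-irrefl; <-cmp; <⇒≢; ≤∧≢⇒<; any?; punchOut-injective; injective⇒≤; *↔×)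
open import Data.Empty using (⊥; ⊥-elim)
open import Data.Product using (_×_; _,_; ∃; Σ; proj₁; proj₂)
open import Data.Sum using (_⊎_; inj₁; inj₂)
open import Relation.Binary.Definitions using (tri<; tri≈; tri>; Transitive; Decidable)
open import Relation.Nullary using (¬_; yes; no; Dec)
open import Relation.Nullary.Decidable using (_×-dec_; _⊎-dec_; map′; T?; ⌊_⌋; toWitness; fromWitness; ¬?; decidable-stable)
open import Relation.Binary.PropositionalEquality
open import Data.Bool using (Bool; true; false; _∧_; _∨_; not; T)
open import Data.Bool.Properties using (T-∧; T-∨; T-irrelevant)
open import Data.List using (List; []; _∷_; allFin; foldl; cartesianProduct)
open import Data.List.Membership.Propositional using (_∈_)
open import Data.List.Membership.Propositional.Properties using (∈-allFin; ∈-cartesianProduct⁺)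
open import Data.List.Relation.Unary.Any using (here; there)
open import Data.Vec using (lookup; tabulate)
open import Data.Vec.Properties using (lookup∘tabulate; tabulate∘lookup; tabulate-cong)
open import Function.Bundles using (Equivalence; _⇔_; mk⇔; _↔_; Inverse; Bijection)
open import Function.Definitions using (Injective)
open import Data.Product.Function.NonDependent.Propositional using (_×-↔_)
open import Function.Properties.Inverse using (↔-sym; ↔-trans)
open import Function.Base using (_∘′_; flip)

variable
  i k n : ℕ

T-not⇒¬T : ∀ {b} → T (not b) → ¬ T b
T-not⇒¬T {false} _ ()

¬T⇒T-not : ∀ {b} → ¬ T b → T (not b)
¬T⇒T-not {false} _ = _
¬T⇒T-not {true} ¬t = ¬t _

T-injective : ∀ {a b} → (T a → T b) → (T b → T a) → a ≡ b
T-injective {false} {false} _ _ = refl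
T-injective {false} {true} _ g = ⊥-elim (g _)
T-injective {true} {false} f _ = ⊥-elim (f _)
T-injective {true} {true} _ _ = refl

T-implies⇔ : ∀ {a b} → T (not a ∨ b) ⇔ (T a → T b)
T-implies⇔ {false} = mk⇔ (λ _ ()) (λ _ → _)
T-implies⇔ {true} = mk⇔ (λ t _ → t) (λ f → f _)

allB⇔ : ∀ {A : Set} (p : A → Bool) xs → T (allB p xs) ⇔ (∀ x → x ∈ xs → T (p x))
allB⇔ p xs = mk⇔ (forth xs) (back xs)
  where
  forth : ∀ xs → T (allB p xs) → ∀ x → x ∈ xs → T (p x)
  forth (y ∷ ys) t x (here refl) = proj₁ (Equivalence.to T-∧ t)
  forth (y ∷ ys) t x (there x∈ys) = forth ys (proj₂ (Equivalence.to T-∧ t)) x x∈ys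
  back : ∀ xs → (∀ x → x ∈ xs → T (p x)) → T (allB p xs)
  back [] _ = _
  back (y ∷ ys) h = Equivalence.from T-∧ (h y (here refl) , back ys (λ x x∈ys → h x (there x∈ys)))

allB-allFin⇔ : ∀ {k} (p : Fin k → Bool) → T (allB p (allFin k)) ⇔ (∀ x → T (p x))
allB-allFin⇔ {k} p = mk⇔ (λ t x → Equivalence.to (allB⇔ p (allFin k)) t x (∈-allFin x))
                         (λ h → Equivalence.from (allB⇔ p (allFin k)) (λ x _ → h x))

module _ {A : Set} {_≺_ : A → A → Set} (≺-trans : Transitive _≺_) (≺-irrefl : ∀ {a} → ¬ a ≺ a) (_≺?_ : Decidable _≺_)
         {P : A → Set} (P? : ∀ a → Dec (P a)) where

  maximal-above : ∀ xs {a} → P a →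
                  ∃ λ b → P b × (∀ {c} → b ≺ c → a ≺ c) × (∀ {c} → c ∈ xs → P c → ¬ b ≺ c)
  maximal-above [] {a} pa = a , pa , (λ a≺c → a≺c) , λ ()
  maximal-above (c ∷ cs) {a} pa with P? c | a ≺? c
  ... | yes pc | yes a≺c =
    let b , pb , b≤ , maxb = maximal-above cs pc in
    b , pb , (λ b≺d → ≺-trans a≺c (b≤ b≺d)) ,
    λ { (here refl) _ b≺c → ≺-irrefl (b≤ b≺c) ; (there c∈cs) → maxb c∈cs }
  ... | yes pc | no a⊀c =
    let b , pb , b≤ , maxb = maximal-above cs pa in
    b , pb , b≤ , λ { (here refl) _ b≺c → a⊀c (b≤ b≺c) ; (there c∈cs) → maxb c∈cs }
  ... | no ¬pc | _ =
    let b , pb , b≤ , maxb = maximal-above cs pa in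
    b , pb , b≤ , λ { (here refl) pc → ⊥-elim (¬pc pc) ; (there c∈cs) → maxb c∈cs }

fin-injective⇒surjective : ∀ {k} (f : Fin k → Fin k) → Injective _≡_ _≡_ f → ∀ y → ∃ λ x → f x ≡ y
fin-injective⇒surjective {suc k} f f-inj y with any? (λ x → f x ≟ y)
... | yes hit = hit
... | no miss = ⊥-elim (1+n≰n (injective⇒≤ {f = g} g-inj))
  where
  y≢f : ∀ x → y ≢ f x
  y≢f x e = miss (x , sym e)
  g : Fin (suc k) → Fin k
  g x = punchOut (y≢f x)
  g-inj : Injective _≡_ _≡_ g
  g-inj {a} {b} e = f-inj (punchOut-injective (y≢f a) (y≢f b) e)

module _ {A : Set} {k : ℕ} (A↔Fin : A ↔ Fin k) where

  open Inverse A↔Fin using () renaming (to to encode; from to decode; inverseˡ to encode-decode; inverseʳ to decode-encode)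

  injective⇒surjective : (f : A → A) → Injective _≡_ _≡_ f → ∀ y → ∃ λ x → f x ≡ y
  injective⇒surjective f f-inj y =
    let i , e = fin-injective⇒surjective (λ i → encode (f (decode i))) f′-inj (encode y)
    in decode i , trans (sym (decode-encode refl)) (trans (cong decode e) (decode-encode refl))
    where
    f′-inj : Injective _≡_ _≡_ (λ i → encode (f (decode i)))
    f′-inj {i} {j} e = trans (sym (encode-decode refl))
      (trans (cong encode (f-inj (trans (sym (decode-encode refl)) (trans (cong decode e) (decode-encode refl)))))
             (encode-decode refl))

  injectiveOn⇒surjectiveOn : {P : A → Set} → (∀ x → Dec (P x)) → (f : ∀ x → P x → A) →
                             (∀ {x} (p : P x) → P (f x p)) → (∀ {x y} (p : P x) (q : P y) → f x p ≡ f y q → x ≡ y) →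
                             ∀ {y} → P y → ∃ λ x → Σ (P x) λ p → f x p ≡ y
  injectiveOn⇒surjectiveOn {P} P? f f-closed f-inj {y} py with injective⇒surjective g g-inj y
    where
    extend : ∀ x → Dec (P x) → A
    extend x (yes p) = f x p
    extend x (no _) = x
    g : A → A
    g x = extend x (P? x)
    g-inj : Injective _≡_ _≡_ g
    g-inj {x} {x′} = cases (P? x) (P? x′)
      where
      cases : (dx : Dec (P x)) (dx′ : Dec (P x′)) → extend x dx ≡ extend x′ dx′ → x ≡ x′
      cases (yes p) (yes p′) e = f-inj p p′ e
      cases (yes p) (no ¬p′) refl = ⊥-elim (¬p′ (f-closed p))
      cases (no ¬p) (yes p′) refl = ⊥-elim (¬p (f-closed p′))
      cases (no _) (no _) e = e
  ... | x , e with P? x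
  ...   | yes p = x , p , e
  ...   | no ¬p = ⊥-elim (¬p (subst P (sym e) py))

-- The cyclic order and the polygon

-- Going around the circle from a, one meets x strictly before b.
Between : Fin k → Fin k → Fin k → Set
Between a x b = (a < x × x < b) ⊎ (b < a × a < x) ⊎ (x < b × b < a)

between-rotate : {a x b : Fin k} → Between a x b → Between x b a
between-rotate (inj₁ p) = inj₂ (inj₁ p)
between-rotate (inj₂ (inj₁ p)) = inj₂ (inj₂ p)
between-rotate (inj₂ (inj₂ p)) = inj₁ p

between-rotate⁻¹ : {a x b : Fin k} → Between a x b → Between b a x
between-rotate⁻¹ bt = between-rotate (between-rotate bt)

between-asym : {a x b : Fin k} → Between a x b → ¬ Between b x a
between-asym (inj₁ (p , q)) (inj₁ (r , s)) = <-asym q r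
between-asym (inj₁ (p , q)) (inj₂ (inj₁ (r , s))) = <-asym q s
between-asym (inj₁ (p , q)) (inj₂ (inj₂ (r , s))) = <-asym p r
between-asym (inj₂ (inj₁ (p , q))) (inj₁ (r , s)) = <-asym q s
between-asym (inj₂ (inj₁ (p , q))) (inj₂ (inj₁ (r , s))) = <-asym p r
between-asym (inj₂ (inj₁ (p , q))) (inj₂ (inj₂ (r , s))) = <-asym q r
between-asym (inj₂ (inj₂ (p , q))) (inj₁ (r , s)) = <-asym p r
between-asym (inj₂ (inj₂ (p , q))) (inj₂ (inj₁ (r , s))) = <-asym q r
between-asym (inj₂ (inj₂ (p , q))) (inj₂ (inj₂ (r , s))) = <-asym q s

between-trans : {a b c d : Fin k} → Between a b c → Between a c d → Between a b d
between-trans (inj₁ (p , q)) (inj₁ (r , s)) = inj₁ (p , <-trans q s)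
between-trans (inj₁ (p , q)) (inj₂ (inj₁ (r , s))) = inj₂ (inj₁ (r , p))
between-trans (inj₁ (p , q)) (inj₂ (inj₂ (r , s))) = ⊥-elim (<-asym (<-trans r s) (<-trans p q))
between-trans (inj₂ (inj₁ (p , q))) (inj₁ (r , s)) = ⊥-elim (<-asym p r)
between-trans (inj₂ (inj₁ (p , q))) (inj₂ (inj₁ (r , s))) = ⊥-elim (<-asym p s)
between-trans (inj₂ (inj₁ (p , q))) (inj₂ (inj₂ (r , s))) = inj₂ (inj₁ (s , q))
between-trans (inj₂ (inj₂ (p , q))) (inj₁ (r , s)) = ⊥-elim (<-asym q r)
between-trans (inj₂ (inj₂ (p , q))) (inj₂ (inj₁ (r , s))) = ⊥-elim (<-asym q s)
between-trans (inj₂ (inj₂ (p , q))) (inj₂ (inj₂ (r , s))) = inj₂ (inj₂ (<-trans p r , s))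

between-total : {a x b : Fin k} → a ≢ x → x ≢ b → a ≢ b → Between a x b ⊎ Between b x a
between-total {a = a} {x} {b} ax xb ab with <-cmp a x | <-cmp x b | <-cmp a b
... | tri≈ _ e _ | _ | _ = ⊥-elim (ax e)
... | _ | tri≈ _ e _ | _ = ⊥-elim (xb e)
... | _ | _ | tri≈ _ e _ = ⊥-elim (ab e)
... | tri< p _ _ | tri< q _ _ | _ = inj₁ (inj₁ (p , q))
... | tri< p _ _ | tri> _ _ q | tri< r _ _ = inj₂ (inj₂ (inj₁ (r , q)))
... | tri< p _ _ | tri> _ _ q | tri> _ _ r = inj₁ (inj₂ (inj₁ (r , p)))
... | tri> _ _ p | tri< q _ _ | tri< r _ _ = inj₂ (inj₂ (inj₂ (p , r)))
... | tri> _ _ p | tri< q _ _ | tri> _ _ r = inj₁ (inj₂ (inj₂ (q , r)))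
... | tri> _ _ p | tri> _ _ q | _ = inj₂ (inj₁ (q , p))

between⇒≢ˡ : {a x b : Fin k} → Between a x b → a ≢ x
between⇒≢ˡ (inj₁ (p , q)) = <⇒≢ p
between⇒≢ˡ (inj₂ (inj₁ (p , q))) = <⇒≢ q
between⇒≢ˡ (inj₂ (inj₂ (p , q))) refl = <-asym p q

between⇒≢ʳ : {a x b : Fin k} → Between a x b → x ≢ b
between⇒≢ʳ bt = between⇒≢ˡ (between-rotate bt)

between-chain : {a b c d : Fin k} → Between a b c → Between a c d → Between b c d
between-chain p q = between-rotate⁻¹ (between-trans (between-rotate q) (between-rotate⁻¹ p))

between-split : {a b c d : Fin k} → Between a b d → Between b c d → Between a c d × Between a b c
between-split p q =
  between-rotate (between-trans (between-rotate⁻¹ p) (between-rotate⁻¹ q)) ,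
  between-rotate⁻¹ (between-trans q (between-rotate p))

between? : (a x b : Fin k) → Dec (Between a x b)
between? a x b = (a <? x ×-dec x <? b) ⊎-dec (b <? a ×-dec a <? x) ⊎-dec (x <? b ×-dec b <? a)

-- vertex i is i modulo 3 + n.
opaque
  vertex : ℕ → Vtx n
  vertex {n} i = fromℕ< (m%n<n i (3 + n))

  toℕ-vertex : ∀ i → toℕ (vertex {n} i) ≡ i % (3 + n)
  toℕ-vertex i = toℕ-fromℕ< _

infixl 6 _+ᵥ_
_+ᵥ_ : Vtx n → ℕ → Vtx n
v +ᵥ i = vertex (toℕ v + i)

next prev : Vtx n → Vtx n
next v = v +ᵥ 1
prev {n} v = v +ᵥ (2 + n)

vertex-toℕ : (v : Vtx n) → vertex (toℕ v) ≡ v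
vertex-toℕ v = toℕ-injective (trans (toℕ-vertex (toℕ v)) (m<n⇒m%n≡m (toℕ<n v)))

vertex-+ᵥ : ∀ i j → vertex {n} i +ᵥ j ≡ vertex (i + j)
vertex-+ᵥ {n} i j = toℕ-injective (begin
  toℕ (vertex i +ᵥ j)              ≡⟨ toℕ-vertex (toℕ (vertex {n} i) + j) ⟩
  (toℕ (vertex {n} i) + j) % m      ≡⟨ cong (λ z → (z + j) % m) (toℕ-vertex i) ⟩
  (i % m + j) % m                   ≡⟨ %-distribˡ-+ (i % m) j m ⟩
  (i % m % m + j % m) % m           ≡⟨ cong (λ z → (z + j % m) % m) (m%n%n≡m%n i m) ⟩
  (i % m + j % m) % m               ≡⟨ %-distribˡ-+ i j m ⟨
  (i + j) % m                       ≡⟨ toℕ-vertex (i + j) ⟨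
  toℕ (vertex {n} (i + j))          ∎)
  where
  open ≡-Reasoning
  m : ℕ
  m = 3 + n

+ᵥ-assoc : (v : Vtx n) → ∀ i j → v +ᵥ i +ᵥ j ≡ v +ᵥ (i + j)
+ᵥ-assoc v i j = trans (vertex-+ᵥ (toℕ v + i) j) (cong vertex (+-assoc (toℕ v) i j))

vertex-+m : ∀ i → vertex {n} (i + (3 + n)) ≡ vertex i
vertex-+m {n} i = toℕ-injective (trans (toℕ-vertex (i + (3 + n))) (trans ([m+n]%n≡m%n i (3 + n)) (sym (toℕ-vertex i))))

+ᵥ-m : (v : Vtx n) → v +ᵥ (3 + n) ≡ v
+ᵥ-m v = trans (vertex-+m (toℕ v)) (vertex-toℕ v)

next-prev : (v : Vtx n) → next (prev v) ≡ v
next-prev {n} v = begin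
  v +ᵥ (2 + n) +ᵥ 1     ≡⟨ +ᵥ-assoc v (2 + n) 1 ⟩
  v +ᵥ (2 + n + 1)      ≡⟨ cong (v +ᵥ_) (+-comm (2 + n) 1) ⟩
  v +ᵥ (3 + n)          ≡⟨ +ᵥ-m v ⟩
  v                     ∎
  where open ≡-Reasoning

+ᵥ-≢ : (v : Vtx n) → 0 ℕ.< i → i ℕ.< 3 + n → v +ᵥ i ≢ v
+ᵥ-≢ {n} {i} v 0<i i<m e with toℕ v + i ℕ.<? 3 + n
... | yes lt = ℕ.<-irrefl (sym (trans (sym (m<n⇒m%n≡m lt)) v+i%m≡v)) (m<m+n (toℕ v) 0<i)
  where
  v+i%m≡v : (toℕ v + i) % (3 + n) ≡ toℕ v
  v+i%m≡v = trans (sym (toℕ-vertex (toℕ v + i))) (cong toℕ e)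
... | no ge = ℕ.<-irrefl refl (subst (ℕ._< 3 + n) (+-cancelˡ-≡ (toℕ v) _ _ v+i≡v+m) i<m)
  where
  m≤v+i : 3 + n ℕ.≤ toℕ v + i
  m≤v+i = ≮⇒≥ ge
  small : toℕ v + i ∸ (3 + n) ℕ.< 3 + n
  small = subst (toℕ v + i ∸ (3 + n) ℕ.<_) (m+n∸n≡m (3 + n) (3 + n)) (∸-monoˡ-< (+-mono-< (toℕ<n v) i<m) m≤v+i)
  v+i-m≡v : toℕ v + i ∸ (3 + n) ≡ toℕ v
  v+i-m≡v = trans (sym (m<n⇒m%n≡m small))
              (trans (m≤n⇒[n∸m]%m≡n%m m≤v+i) (trans (sym (toℕ-vertex (toℕ v + i))) (cong toℕ e)))
  v+i≡v+m : toℕ v + i ≡ toℕ v + (3 + n)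
  v+i≡v+m = trans (sym (m∸n+n≡m m≤v+i)) (cong (ℕ._+ (3 + n)) v+i-m≡v)

next-≢ : (v : Vtx n) → next v ≢ v
next-≢ v = +ᵥ-≢ v (s≤s z≤n) (s≤s (s≤s z≤n))

+ᵥ-reaches : (v w : Vtx n) → ∃ λ i → v +ᵥ i ≡ w
+ᵥ-reaches {n} v w = offset , (begin
  vertex (toℕ v + offset)    ≡⟨ cong vertex v+offset≡w+m ⟩
  vertex (toℕ w + (3 + n))   ≡⟨ vertex-+m (toℕ w) ⟩
  vertex (toℕ w)             ≡⟨ vertex-toℕ w ⟩
  w                          ∎)
  where
  open ≡-Reasoning
  offset : ℕ
  offset = toℕ w + (3 + n) ∸ toℕ v
  v+offset≡w+m : toℕ v + offset ≡ toℕ w + (3 + n)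
  v+offset≡w+m = m+[n∸m]≡n (≤-trans (<⇒≤ (toℕ<n v)) (m≤n+m (3 + n) (toℕ w)))

toℕ-next : (v : Vtx n) → (toℕ (next v) ≡ suc (toℕ v)) ⊎ (toℕ v ≡ 2 + n × toℕ (next v) ≡ 0)
toℕ-next {n} v with suc (toℕ v) ℕ.<? 3 + n
... | yes lt = inj₁ (trans (toℕ-vertex (toℕ v + 1)) (trans (cong (_% (3 + n)) (+-comm (toℕ v) 1)) (m<n⇒m%n≡m lt)))
... | no ge = inj₂ (v≡m-1 , (begin
  toℕ (next v)            ≡⟨ toℕ-vertex (toℕ v + 1) ⟩
  (toℕ v + 1) % (3 + n)    ≡⟨ cong (λ z → (z + 1) % (3 + n)) v≡m-1 ⟩
  (2 + n + 1) % (3 + n)    ≡⟨ cong (_% (3 + n)) (+-comm (2 + n) 1) ⟩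
  (3 + n) % (3 + n)        ≡⟨ n%n≡0 (3 + n) ⟩
  0                        ∎))
  where
  open ≡-Reasoning
  v≡m-1 : toℕ v ≡ 2 + n
  v≡m-1 = ℕ.≤-antisym (s≤s⁻¹ (toℕ<n v)) (s≤s⁻¹ (≮⇒≥ ge))

¬between-next : {v x : Vtx n} → ¬ Between v x (next v)
¬between-next {v = v} {x} bt with toℕ-next v | bt
... | inj₁ e | inj₁ (p , q) = ℕ.<⇒≱ p (s≤s⁻¹ (subst (toℕ x ℕ.<_) e q))
... | inj₁ e | inj₂ (inj₁ (p , q)) = ℕ.<-asym (subst (ℕ._< toℕ v) e p) (ℕ.n<1+n (toℕ v))
... | inj₁ e | inj₂ (inj₂ (p , q)) = ℕ.<-asym (subst (ℕ._< toℕ v) e q) (ℕ.n<1+n (toℕ v))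
... | inj₂ (_ , e) | inj₁ (p , q) = ℕ.n≮0 (subst (toℕ x ℕ.<_) e q)
... | inj₂ (e , _) | inj₂ (inj₁ (p , q)) = ℕ.<⇒≱ (subst (ℕ._< toℕ x) e q) (s≤s⁻¹ (toℕ<n x))
... | inj₂ (_ , e) | inj₂ (inj₂ (p , q)) = ℕ.n≮0 (subst (toℕ x ℕ.<_) e p)

between-next⇒between : {v x w : Vtx n} → Between v x (next w) → x ≢ w → Between v x w
between-next⇒between {v = v} {x} {w} bt x≢w with between-total (between⇒≢ˡ bt) x≢w v≢w
  where
  v≢w : v ≢ w
  v≢w refl = ¬between-next bt
... | inj₁ vxw = vxw
... | inj₂ wxv = ⊥-elim (¬between-next (between-rotate⁻¹ (between-trans (between-rotate bt) (between-rotate wxv))))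

next-between : {v w : Vtx n} → w ≢ v → w ≢ next v → Between v (next v) w
next-between {v = v} {w} w≢v w≢next with between-total (λ e → next-≢ v (sym e)) (λ e → w≢next (sym e)) (λ e → w≢v (sym e))
... | inj₁ bt = bt
... | inj₂ bt = ⊥-elim (¬between-next (between-rotate⁻¹ bt))

next-vertex : ∀ i → next (vertex {n} i) ≡ vertex (suc i)
next-vertex i = trans (vertex-+ᵥ i 1) (cong vertex (+-comm i 1))

-- Diagonals and crossings

record NonAdjacent {n : ℕ} (x y : Vtx n) : Set where
  constructor nonAdjacent
  field
    distinct : x ≢ y
    nextˡ≢   : next x ≢ y
    nextʳ≢   : next y ≢ x

open NonAdjacent public

nonAdjacent-sym : {x y : Vtx n} → NonAdjacent x y → NonAdjacent y x
nonAdjacent-sym (nonAdjacent x≢y p q) = nonAdjacent (λ e → x≢y (sym e)) q p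

isDiag⇔ : {a b : Vtx n} → T (isDiag n a b) ⇔ (a < b × NonAdjacent a b)
isDiag⇔ {n} {a} {b} = mk⇔ forth back
  where
  forth : T (isDiag n a b) → a < b × NonAdjacent a b
  forth t = a<b , nonAdjacent (λ { refl → <-irrefl refl a<b }) next-a≢b next-b≢a
    where
    a+2≤b : suc (suc (toℕ a)) ℕ.≤ toℕ b
    a+2≤b = ≤ᵇ⇒≤ _ _ (proj₁ (Equivalence.to T-∧ t))
    a<b : a < b
    a<b = ℕ.<-trans (ℕ.n<1+n _) a+2≤b
    next-a≢b : next a ≢ b
    next-a≢b refl with toℕ-next a
    ... | inj₁ e = ℕ.<-irrefl (sym e) a+2≤b
    ... | inj₂ (_ , e) = ℕ.n≮0 (subst (suc (suc (toℕ a)) ℕ.≤_) e a+2≤b)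
    next-b≢a : next b ≢ a
    next-b≢a refl with toℕ-next b
    ... | inj₁ e = <-asym a<b (subst (ℕ._≤ toℕ (next b)) e ℕ.≤-refl)
    ... | inj₂ (b≡m-1 , e) = T-not⇒¬T (proj₂ (Equivalence.to T-∧ t))
                               (Equivalence.from T-∧ (≡⇒≡ᵇ _ _ e , ≡⇒≡ᵇ _ _ b≡m-1))
  back : a < b × NonAdjacent a b → T (isDiag n a b)
  back (a<b , nonAdjacent _ next-a≢b next-b≢a) = Equivalence.from T-∧ (≤⇒≤ᵇ a+2≤b , not-polygon-side)
    where
    a+2≤b : suc (suc (toℕ a)) ℕ.≤ toℕ b
    a+2≤b with ℕ.m≤n⇒m<n∨m≡n a<b | toℕ-next a
    ... | inj₁ lt | _ = lt
    ... | inj₂ e | inj₁ e′ = ⊥-elim (next-a≢b (toℕ-injective (trans e′ e)))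
    ... | inj₂ e | inj₂ (a≡m-1 , _) = ⊥-elim (ℕ.<-irrefl (trans (sym e) (cong suc a≡m-1)) (toℕ<n b))
    not-polygon-side : T (not ((toℕ a ≡ᵇ 0) ∧ (toℕ b ≡ᵇ suc (suc n))))
    not-polygon-side = ¬T⇒T-not λ t → side (Equivalence.to T-∧ t) (toℕ-next b)
      where
      side : T (toℕ a ≡ᵇ 0) × T (toℕ b ≡ᵇ suc (suc n)) → (toℕ (next b) ≡ suc (toℕ b)) ⊎ (toℕ b ≡ 2 + n × toℕ (next b) ≡ 0) → ⊥
      side (a≡0 , b≡m-1) (inj₁ e) = ℕ.<-irrefl (cong suc (≡ᵇ⇒≡ _ _ b≡m-1)) (subst (ℕ._< 3 + n) e (toℕ<n (next b)))
      side (a≡0 , _) (inj₂ (_ , e)) = next-b≢a (toℕ-injective (trans e (sym (≡ᵇ⇒≡ _ _ a≡0))))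

Crossing : Vtx n → Vtx n → Vtx n → Vtx n → Set
Crossing a b c d = (Between a c b × Between b d a) ⊎ (Between b c a × Between a d b)

crossing-swapˡ : {a b c d : Vtx n} → Crossing a b c d → Crossing b a c d
crossing-swapˡ (inj₁ x) = inj₂ x
crossing-swapˡ (inj₂ x) = inj₁ x

crossing-swapʳ : {a b c d : Vtx n} → Crossing a b c d → Crossing a b d c
crossing-swapʳ (inj₁ (p , q)) = inj₂ (q , p)
crossing-swapʳ (inj₂ (p , q)) = inj₁ (q , p)

crossing-sym : {a b c d : Vtx n} → Crossing a b c d → Crossing c d a b
crossing-sym (inj₁ (acb , bda)) =
  inj₂ (between-rotate⁻¹ (between-trans acb (between-rotate⁻¹ bda)) ,
        between-rotate⁻¹ (between-trans bda (between-rotate⁻¹ acb)))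
crossing-sym (inj₂ x) = crossing-swapʳ (crossing-sym (inj₁ x))

private
  interlaced : Vtx n → Vtx n → Vtx n → Vtx n → Bool
  interlaced a b c d = (toℕ a <ᵇ toℕ c) ∧ (toℕ c <ᵇ toℕ b) ∧ (toℕ b <ᵇ toℕ d)

crosses⇔Crossing : {a b c d : Vtx n} → a < b → c < d → T (crosses n a b c d) ⇔ Crossing a b c d
crosses⇔Crossing {n} {a} {b} {c} {d} a<b c<d = mk⇔ forth back
  where
  lt : ∀ {x y : Vtx n} → T (toℕ x <ᵇ toℕ y) → x < y
  lt = <ᵇ⇒< _ _
  forth : T (crosses n a b c d) → Crossing a b c d
  forth t with Equivalence.to T-∨ t
  ... | inj₁ u with Equivalence.to T-∧ u
  ...   | a<c , v with Equivalence.to T-∧ v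
  ...     | c<b , b<d = inj₁ (inj₁ (lt a<c , lt c<b) , inj₂ (inj₁ (<-trans (lt a<c) (lt c<b) , lt b<d)))
  forth t | inj₂ u with Equivalence.to T-∧ u
  ...   | c<a , v with Equivalence.to T-∧ v
  ...     | a<d , d<b = inj₂ (inj₂ (inj₂ (lt c<a , <-trans (lt a<d) (lt d<b))) , inj₁ (lt a<d , lt d<b))
  interleave : ∀ {w x y z : Vtx n} → w < x → x < y → y < z → T (interlaced w y x z)
  interleave p q r = Equivalence.from T-∧ (<⇒<ᵇ p , Equivalence.from T-∧ (<⇒<ᵇ q , <⇒<ᵇ r))
  inside : ∀ {x} → Between a x b → a < x × x < b
  inside (inj₁ p) = p
  inside (inj₂ (inj₁ (p , _))) = ⊥-elim (<-asym a<b p)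
  inside (inj₂ (inj₂ (_ , q))) = ⊥-elim (<-asym a<b q)
  outside : ∀ {x} → Between b x a → x < a ⊎ b < x
  outside (inj₁ (p , q)) = ⊥-elim (<-asym a<b (<-trans p q))
  outside (inj₂ (inj₁ (_ , q))) = inj₂ q
  outside (inj₂ (inj₂ (p , _))) = inj₁ p
  back : Crossing a b c d → T (crosses n a b c d)
  back (inj₁ (acb , bda)) with inside acb | outside bda
  ... | a<c , c<b | inj₁ d<a = ⊥-elim (<-asym (<-trans a<c c<d) d<a)
  ... | a<c , c<b | inj₂ b<d = Equivalence.from T-∨ (inj₁ (interleave a<c c<b b<d))
  back (inj₂ (bca , adb)) with inside adb | outside bca
  ... | a<d , d<b | inj₁ c<a = Equivalence.from T-∨ (inj₂ (interleave c<a a<d d<b))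
  ... | a<d , d<b | inj₂ b<c = ⊥-elim (<-asym d<b (<-trans b<c c<d))

crosses-sym : (a b c d : Vtx n) → T (crosses n a b c d) → T (crosses n c d a b)
crosses-sym a b c d t with Equivalence.to (T-∨ {interlaced a b c d} {interlaced c d a b}) t
... | inj₁ u = Equivalence.from T-∨ (inj₂ u)
... | inj₂ u = Equivalence.from T-∨ (inj₁ u)

crosses-irrefl : (a b : Vtx n) → ¬ T (crosses n a b a b)
crosses-irrefl a b t with Equivalence.to (T-∨ {interlaced a b a b} {interlaced a b a b}) t
... | inj₁ u = <-irrefl refl (<ᵇ⇒< (toℕ a) _ (proj₁ (Equivalence.to T-∧ u)))
... | inj₂ u = <-irrefl refl (<ᵇ⇒< (toℕ a) _ (proj₁ (Equivalence.to T-∧ u)))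

record Diagonal (n : ℕ) : Set where
  constructor diagonal
  field
    lo hi : Vtx n
    isDiagonal : T (isDiag n lo hi)

open Diagonal public

diagonal-≡ : {d e : Diagonal n} → lo d ≡ lo e → hi d ≡ hi e → d ≡ e
diagonal-≡ {d = diagonal a b p} {diagonal .a .b q} refl refl = cong (diagonal a b) (T-irrelevant p q)

lo<hi : (d : Diagonal n) → lo d < hi d
lo<hi d = proj₁ (Equivalence.to isDiag⇔ (isDiagonal d))

lo-hi-nonAdjacent : (d : Diagonal n) → NonAdjacent (lo d) (hi d)
lo-hi-nonAdjacent d = proj₂ (Equivalence.to isDiag⇔ (isDiagonal d))

infix 4 _⋈_
record _⋈_ {n : ℕ} (d e : Diagonal n) : Set where
  constructor cross
  field
    crossing : Crossing (lo d) (hi d) (lo e) (hi e)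

open _⋈_ public

⋈-sym : {d e : Diagonal n} → d ⋈ e → e ⋈ d
⋈-sym (cross c) = cross (crossing-sym c)

crosses⇔⋈ : (d e : Diagonal n) → T (crosses n (lo d) (hi d) (lo e) (hi e)) ⇔ d ⋈ e
crosses⇔⋈ d e = mk⇔ (λ t → cross (Equivalence.to (crosses⇔Crossing (lo<hi d) (lo<hi e)) t))
                    (λ c → Equivalence.from (crosses⇔Crossing (lo<hi d) (lo<hi e)) (crossing c))

_⋈?_ : (d e : Diagonal n) → Dec (d ⋈ e)
d ⋈? e = map′ (Equivalence.to (crosses⇔⋈ d e)) (Equivalence.from (crosses⇔⋈ d e)) (T? _)

Endpoint : Vtx n → Diagonal n → Set
Endpoint v d = v ≡ lo d ⊎ v ≡ hi d

-- Abstract, so that chords are compared by their endpoints, never by unfolding the decision x <? y.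
abstract
  chord : (x y : Vtx n) → NonAdjacent x y → Diagonal n
  chord x y p with x <? y
  ... | yes x<y = diagonal x y (Equivalence.from isDiag⇔ (x<y , p))
  ... | no x≮y = diagonal y x (Equivalence.from isDiag⇔ (y<x , nonAdjacent-sym p))
    where
    y<x : y < x
    y<x = ≤∧≢⇒< (ℕ.≮⇒≥ x≮y) (λ e → distinct p (sym e))

  chord-ends : (x y : Vtx n) (p : NonAdjacent x y) →
               (lo (chord x y p) ≡ x × hi (chord x y p) ≡ y) ⊎ (lo (chord x y p) ≡ y × hi (chord x y p) ≡ x)
  chord-ends x y p with x <? y
  ... | yes _ = inj₁ (refl , refl)
  ... | no _ = inj₂ (refl , refl)

  toℕ-chord : (x y : Vtx n) (p : NonAdjacent x y) →
              toℕ (lo (chord x y p)) ≡ toℕ x ⊓ toℕ y × toℕ (hi (chord x y p)) ≡ toℕ x ⊔ toℕ y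
  toℕ-chord x y p with x <? y
  ... | yes x<y = sym (ℕ.m≤n⇒m⊓n≡m (ℕ.<⇒≤ x<y)) , sym (ℕ.m≤n⇒m⊔n≡n (ℕ.<⇒≤ x<y))
  ... | no x≮y = sym (ℕ.m≥n⇒m⊓n≡n (ℕ.≮⇒≥ x≮y)) , sym (ℕ.m≥n⇒m⊔n≡m (ℕ.≮⇒≥ x≮y))

module _ {x y : Vtx n} (p : NonAdjacent x y) where

  chord-endpointˡ : Endpoint x (chord x y p)
  chord-endpointˡ with chord-ends x y p
  ... | inj₁ (e , _) = inj₁ (sym e)
  ... | inj₂ (_ , e) = inj₂ (sym e)

  chord-endpointʳ : Endpoint y (chord x y p)
  chord-endpointʳ with chord-ends x y p
  ... | inj₁ (_ , e) = inj₂ (sym e)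
  ... | inj₂ (e , _) = inj₁ (sym e)

  endpoint-chord : {w : Vtx n} → Endpoint w (chord x y p) → w ≡ x ⊎ w ≡ y
  endpoint-chord ew with chord-ends x y p | ew
  ... | inj₁ (e , _) | inj₁ w≡lo = inj₁ (trans w≡lo e)
  ... | inj₁ (_ , e) | inj₂ w≡hi = inj₂ (trans w≡hi e)
  ... | inj₂ (e , _) | inj₁ w≡lo = inj₂ (trans w≡lo e)
  ... | inj₂ (_ , e) | inj₂ w≡hi = inj₁ (trans w≡hi e)

  chord-crossing⇔ : {c d : Vtx n} → Crossing (lo (chord x y p)) (hi (chord x y p)) c d ⇔ Crossing x y c d
  chord-crossing⇔ {c} {d} with chord-ends x y p
  ... | inj₁ (e₁ , e₂) = mk⇔ (subst₂ ends e₁ e₂) (subst₂ ends (sym e₁) (sym e₂))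
    where ends = λ a b → Crossing a b c d
  ... | inj₂ (e₁ , e₂) = mk⇔ (λ cr → crossing-swapˡ (subst₂ ends e₁ e₂ cr)) (λ cr → subst₂ ends (sym e₁) (sym e₂) (crossing-swapˡ cr))
    where ends = λ a b → Crossing a b c d

chord-⋈-chord : {x y a b : Vtx n} {p : NonAdjacent x y} {q : NonAdjacent a b} → Crossing x y a b → chord x y p ⋈ chord a b q
chord-⋈-chord {p = p} {q} cr = cross (
  Equivalence.from (chord-crossing⇔ p) (crossing-sym (Equivalence.from (chord-crossing⇔ q) (crossing-sym cr))))

diagonal-≡-endpoints : {d e : Diagonal n} → Endpoint (lo d) e → Endpoint (hi d) e → d ≡ e
diagonal-≡-endpoints (inj₁ x) (inj₂ y) = diagonal-≡ x y
diagonal-≡-endpoints {d = d} (inj₁ x) (inj₁ y) = ⊥-elim (distinct (lo-hi-nonAdjacent d) (trans x (sym y)))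
diagonal-≡-endpoints {d = d} (inj₂ x) (inj₂ y) = ⊥-elim (distinct (lo-hi-nonAdjacent d) (trans x (sym y)))
diagonal-≡-endpoints {d = d} {e} (inj₂ x) (inj₁ y) =
  ⊥-elim (<-asym (lo<hi d) (subst₂ _<_ (sym y) (sym x) (lo<hi e)))

≡chord : {x y : Vtx n} (p : NonAdjacent x y) {d : Diagonal n} → Endpoint x d → Endpoint y d → d ≡ chord x y p
≡chord {x = x} {y} p {d} ex ey with chord-ends x y p
... | inj₁ (e₁ , e₂) = sym (diagonal-≡-endpoints (subst (λ z → Endpoint z d) (sym e₁) ex) (subst (λ z → Endpoint z d) (sym e₂) ey))
... | inj₂ (e₁ , e₂) = sym (diagonal-≡-endpoints (subst (λ z → Endpoint z d) (sym e₁) ey) (subst (λ z → Endpoint z d) (sym e₂) ex))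

≡chord-from : {w : Vtx n} (d : Diagonal n) → Endpoint w d → ∃ λ z → Σ (NonAdjacent w z) λ p → d ≡ chord w z p
≡chord-from d (inj₁ refl) = hi d , lo-hi-nonAdjacent d , ≡chord _ (inj₁ refl) (inj₂ refl)
≡chord-from d (inj₂ refl) = lo d , nonAdjacent-sym (lo-hi-nonAdjacent d) , ≡chord _ (inj₂ refl) (inj₁ refl)

-- Dissections and their greedy completion to triangulations

DiagPred : ℕ → Set
DiagPred n = Vtx n → Vtx n → Bool

fromPred : DiagPred n → DiagSet n
fromPred f = tabulate λ a → tabulate (f a)

mem-fromPred : (f : DiagPred n) → ∀ a b → mem (fromPred f) a b ≡ f a b
mem-fromPred f a b = trans (cong (λ row → lookup row b) (lookup∘tabulate (λ a → tabulate (f a)) a)) (lookup∘tabulate (f a) b)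

DiagSet-ext : {S S′ : DiagSet n} → (∀ a b → mem S a b ≡ mem S′ a b) → S ≡ S′
DiagSet-ext {S = S} {S′} h = begin
  S                                     ≡⟨ tabulate∘lookup S ⟨
  tabulate (lookup S)                   ≡⟨ tabulate-cong (λ a → rows a) ⟩
  tabulate (lookup S′)                  ≡⟨ tabulate∘lookup S′ ⟩
  S′                                    ∎
  where
  open ≡-Reasoning
  rows : ∀ a → lookup S a ≡ lookup S′ a
  rows a = trans (sym (tabulate∘lookup (lookup S a))) (trans (tabulate-cong (h a)) (tabulate∘lookup (lookup S′ a)))

record IsDissection (f : DiagPred n) : Set where
  field
    diagonals   : ∀ a b → T (f a b) → T (isDiag n a b)
    noncrossing : ∀ a b c d → T (f a b) → T (f c d) → ¬ T (crosses n a b c d)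

open IsDissection public

isDissection-cong : {f g : DiagPred n} → (∀ a b → f a b ≡ g a b) → IsDissection f → IsDissection g
isDissection-cong f≗g dis = record
  { diagonals = λ a b t → diagonals dis a b (subst T (sym (f≗g a b)) t)
  ; noncrossing = λ a b c d t u → noncrossing dis a b c d (subst T (sym (f≗g a b)) t) (subst T (sym (f≗g c d)) u)
  }

validB⇔ : (S : DiagSet n) → T (validB n S) ⇔ IsDissection (mem S)
validB⇔ {n} S = mk⇔ forth back
  where
  Diagonals : Vtx n → Vtx n → Bool
  Diagonals a b = not (mem S a b) ∨ isDiag n a b
  Noncrossing : Vtx n → Vtx n → Vtx n → Vtx n → Bool
  Noncrossing a b c d = not (mem S a b ∧ mem S c d) ∨ not (crosses n a b c d)
  all₂ : (Vtx n → Vtx n → Bool) → Bool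
  all₂ p = allB (λ a → allB (p a) (allFin _)) (allFin _)
  all₂⇔ : ∀ p → T (all₂ p) ⇔ (∀ a b → T (p a b))
  all₂⇔ p = mk⇔ (λ t a → Equivalence.to (allB-allFin⇔ (p a)) (Equivalence.to (allB-allFin⇔ rows) t a))
                (λ h → Equivalence.from (allB-allFin⇔ rows) (λ a → Equivalence.from (allB-allFin⇔ (p a)) (h a)))
    where
    rows : Vtx n → Bool
    rows a = allB (p a) (allFin _)
  noncrossing⇔ : ∀ a b c d → T (Noncrossing a b c d) ⇔ (T (mem S a b) → T (mem S c d) → ¬ T (crosses n a b c d))
  noncrossing⇔ a b c d = mk⇔
    (λ t u v → T-not⇒¬T (Equivalence.to T-implies⇔ t (Equivalence.from T-∧ (u , v))))
    (λ h → Equivalence.from T-implies⇔ (λ uv → ¬T⇒T-not (h (proj₁ (Equivalence.to T-∧ uv)) (proj₂ (Equivalence.to T-∧ uv)))))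
  validB-parts : T (validB n S) ⇔ (T (all₂ Diagonals) × T (all₂ λ a b → all₂ (Noncrossing a b)))
  validB-parts = T-∧
  forth : T (validB n S) → IsDissection (mem S)
  forth t = record
    { diagonals = λ a b → Equivalence.to T-implies⇔ (Equivalence.to (all₂⇔ Diagonals) (proj₁ (Equivalence.to validB-parts t)) a b)
    ; noncrossing = λ a b c d → Equivalence.to (noncrossing⇔ a b c d)
        (Equivalence.to (all₂⇔ (Noncrossing a b)) (Equivalence.to (all₂⇔ λ a b → all₂ (Noncrossing a b)) (proj₂ (Equivalence.to validB-parts t)) a b) c d)
    }
  back : IsDissection (mem S) → T (validB n S)
  back dis = Equivalence.from validB-parts
    ( Equivalence.from (all₂⇔ Diagonals) (λ a b → Equivalence.from T-implies⇔ (diagonals dis a b))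
    , Equivalence.from (all₂⇔ λ a b → all₂ (Noncrossing a b))
        (λ a b → Equivalence.from (all₂⇔ (Noncrossing a b)) (λ c d → Equivalence.from (noncrossing⇔ a b c d) (noncrossing dis a b c d))))

CrossesSome : DiagPred n → Vtx n → Vtx n → Set
CrossesSome {n} f a b = ∃ λ c → ∃ λ d → T (f c d) × T (crosses n a b c d)

crossesSome? : (f : DiagPred n) → ∀ a b → Dec (CrossesSome f a b)
crossesSome? {n} f a b = any? λ c → any? λ d → T? (f c d) ×-dec T? (crosses n a b c d)

Blocked : DiagPred n → Vtx n → Vtx n → Set
Blocked f a b = T (f a b) ⊎ CrossesSome f a b

_⊆ᵖ_ : DiagPred n → DiagPred n → Set
f ⊆ᵖ g = ∀ a b → T (f a b) → T (g a b)

insert : DiagPred n → Vtx n → Vtx n → DiagPred n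
insert f a b c d = f c d ∨ (⌊ c ≟ a ⌋ ∧ ⌊ d ≟ b ⌋)

module _ {n : ℕ} {f : DiagPred n} {a b : Vtx n} where

  private
    is : Vtx n → Vtx n → Bool
    is c d = ⌊ c ≟ a ⌋ ∧ ⌊ d ≟ b ⌋

  insert-⊇ : f ⊆ᵖ insert f a b
  insert-⊇ c d t = Equivalence.from (T-∨ {f c d} {is c d}) (inj₁ t)

  insert-new : T (insert f a b a b)
  insert-new = Equivalence.from (T-∨ {f a b} {is a b}) (inj₂ (Equivalence.from (T-∧ {⌊ a ≟ a ⌋} {⌊ b ≟ b ⌋}) (fromWitness refl , fromWitness refl)))

  insert-cases : ∀ {c d} → T (insert f a b c d) → T (f c d) ⊎ (c ≡ a × d ≡ b)
  insert-cases {c} {d} t with Equivalence.to (T-∨ {f c d} {is c d}) t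
  ... | inj₁ u = inj₁ u
  ... | inj₂ u with Equivalence.to (T-∧ {⌊ c ≟ a ⌋} {⌊ d ≟ b ⌋}) u
  ...   | c≡a , d≡b = inj₂ (toWitness c≡a , toWitness d≡b)

  insert-isDissection : IsDissection f → T (isDiag n a b) → ¬ CrossesSome f a b → IsDissection (insert f a b)
  insert-isDissection dis ab ¬cross = record { diagonals = diagonals′ ; noncrossing = noncrossing′ }
    where
    diagonals′ : ∀ c d → T (insert f a b c d) → T (isDiag n c d)
    diagonals′ c d t with insert-cases t
    ... | inj₁ u = diagonals dis c d u
    ... | inj₂ (refl , refl) = ab
    noncrossing′ : ∀ c d c′ d′ → T (insert f a b c d) → T (insert f a b c′ d′) → ¬ T (crosses n c d c′ d′)
    noncrossing′ c d c′ d′ t t′ with insert-cases t | insert-cases t′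
    ... | inj₁ u | inj₁ u′ = noncrossing dis c d c′ d′ u u′
    ... | inj₂ (refl , refl) | inj₁ u′ = λ cr → ¬cross (c′ , d′ , u′ , cr)
    ... | inj₁ u | inj₂ (refl , refl) = λ cr → ¬cross (c , d , u , crosses-sym c d a b cr)
    ... | inj₂ (refl , refl) | inj₂ (refl , refl) = crosses-irrefl a b

extendBy : DiagPred n → Vtx n × Vtx n → DiagPred n
extendBy {n} f (a , b) with T? (isDiag n a b) ×-dec ¬? (crossesSome? f a b)
... | yes _ = insert f a b
... | no _ = f

extendBy-⊇ : (f : DiagPred n) → ∀ p → f ⊆ᵖ extendBy f p
extendBy-⊇ {n} f (a , b) with T? (isDiag n a b) ×-dec ¬? (crossesSome? f a b)
... | yes _ = insert-⊇
... | no _ = λ _ _ t → t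

extendBy-isDissection : {f : DiagPred n} → IsDissection f → ∀ p → IsDissection (extendBy f p)
extendBy-isDissection {n} {f} dis (a , b) with T? (isDiag n a b) ×-dec ¬? (crossesSome? f a b)
... | yes (ab , ¬cross) = insert-isDissection dis ab ¬cross
... | no _ = dis

extendBy-blocks : (f : DiagPred n) → ∀ a b → T (isDiag n a b) → Blocked (extendBy f (a , b)) a b
extendBy-blocks {n} f a b ab with T? (isDiag n a b) ×-dec ¬? (crossesSome? f a b)
... | yes _ = inj₁ (insert-new {f = f})
... | no ¬addable with crossesSome? f a b
...   | yes crossing-ab = inj₂ crossing-ab
...   | no ¬cross = ⊥-elim (¬addable (ab , ¬cross))

blocked-mono : {f g : DiagPred n} → f ⊆ᵖ g → ∀ {a b} → Blocked f a b → Blocked g a b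
blocked-mono f⊆g (inj₁ t) = inj₁ (f⊆g _ _ t)
blocked-mono f⊆g (inj₂ (c , d , t , cr)) = inj₂ (c , d , f⊆g c d t , cr)

module _ {n : ℕ} where

  extendAll : DiagPred n → List (Vtx n × Vtx n) → DiagPred n
  extendAll = foldl extendBy

  extendAll-⊇ : (f : DiagPred n) → ∀ ps → f ⊆ᵖ extendAll f ps
  extendAll-⊇ f [] = λ _ _ t → t
  extendAll-⊇ f (p ∷ ps) c d t = extendAll-⊇ (extendBy f p) ps c d (extendBy-⊇ f p c d t)

  extendAll-isDissection : {f : DiagPred n} → IsDissection f → ∀ ps → IsDissection (extendAll f ps)
  extendAll-isDissection dis [] = dis
  extendAll-isDissection dis (p ∷ ps) = extendAll-isDissection (extendBy-isDissection dis p) ps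

  extendAll-blocks : (f : DiagPred n) → ∀ {a b} ps → (a , b) ∈ ps → T (isDiag n a b) → Blocked (extendAll f ps) a b
  extendAll-blocks f {a} {b} (_ ∷ ps) (here refl) ab =
    blocked-mono (extendAll-⊇ (extendBy f (a , b)) ps) (extendBy-blocks f a b ab)
  extendAll-blocks f (p ∷ ps) (there ab∈ps) ab = extendAll-blocks (extendBy f p) ps ab∈ps ab

  allPairs : List (Vtx n × Vtx n)
  allPairs = cartesianProduct (allFin _) (allFin _)

  complete : DiagPred n → DiagPred n
  complete f = extendAll f allPairs

  complete-⊇ : (f : DiagPred n) → f ⊆ᵖ mem (fromPred (complete f))
  complete-⊇ f a b t = subst T (sym (mem-fromPred (complete f) a b)) (extendAll-⊇ f allPairs a b t)

  complete-isTriangulation : {f : DiagPred n} → IsDissection f → IsTriangulation n (fromPred (complete f))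
  complete-isTriangulation {f} dis =
    Equivalence.from (validB⇔ (fromPred (complete f))) (isDissection-cong (λ a b → sym (mem-fromPred (complete f) a b)) (extendAll-isDissection dis allPairs)) ,
    λ a b ab → blocked-mono (λ c d → subst T (sym (mem-fromPred (complete f) c d)))
                 (extendAll-blocks f allPairs (∈-cartesianProduct⁺ (∈-allFin a) (∈-allFin b)) ab)

-- Every diagonal outside a dissection is avoided by a triangulation containing it

data Joined (f : DiagPred n) (u v : Vtx n) : Set where
  forward  : T (f u v) → Joined f u v
  backward : T (f v u) → Joined f u v

joined-sym : {f : DiagPred n} {u v : Vtx n} → Joined f u v → Joined f v u
joined-sym (forward t) = backward t
joined-sym (backward t) = forward t

joined? : (f : DiagPred n) → ∀ u v → Dec (Joined f u v)
joined? f u v with T? (f u v) | T? (f v u)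
... | yes t | _ = yes (forward t)
... | no _ | yes t = yes (backward t)
... | no ¬t | no ¬t′ = no λ { (forward t) → ¬t t ; (backward t) → ¬t′ t }

member-noncrossing : {f : DiagPred n} → IsDissection f → ∀ {a b c d} → T (f a b) → T (f c d) → ¬ Crossing a b c d
member-noncrossing dis {a} {b} {c} {d} s t cr = noncrossing dis a b c d s t
  (Equivalence.from (crosses⇔Crossing (lo<hi (diagonal a b (diagonals dis a b s))) (lo<hi (diagonal c d (diagonals dis c d t)))) cr)

joined-noncrossing : {f : DiagPred n} → IsDissection f → ∀ {a b c d} → Joined f a b → Joined f c d → ¬ Crossing a b c d
joined-noncrossing dis (forward s) (forward t) cr = member-noncrossing dis s t cr
joined-noncrossing dis (forward s) (backward t) cr = member-noncrossing dis s t (crossing-swapʳ cr)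
joined-noncrossing dis (backward s) (forward t) cr = member-noncrossing dis s t (crossing-swapˡ cr)
joined-noncrossing dis (backward s) (backward t) cr = member-noncrossing dis s t (crossing-swapˡ (crossing-swapʳ cr))

OnArc : Vtx n → Vtx n → Vtx n → Set
OnArc x y w = w ≡ x ⊎ w ≡ y ⊎ Between x w y

onArc-or-between : {x y : Vtx n} → x ≢ y → ∀ w → OnArc x y w ⊎ Between y w x
onArc-or-between {x = x} {y} x≢y w with w ≟ x | w ≟ y
... | yes w≡x | _ = inj₁ (inj₁ w≡x)
... | no _ | yes w≡y = inj₁ (inj₂ (inj₁ w≡y))
... | no w≢x | no w≢y with between-total (λ e → w≢x (sym e)) w≢y x≢y
...   | inj₁ xwy = inj₁ (inj₂ (inj₂ xwy))
...   | inj₂ ywx = inj₂ ywx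

noncrossing⇒same-side : {x y c d : Vtx n} → x ≢ y → ¬ Crossing x y c d →
                        (OnArc x y c × OnArc x y d) ⊎ (OnArc y x c × OnArc y x d)
noncrossing⇒same-side {x = x} {y} {c} {d} x≢y ¬cr with onArc-or-between x≢y c | onArc-or-between x≢y d
... | inj₁ c∈ | inj₁ d∈ = inj₁ (c∈ , d∈)
... | inj₁ (inj₁ c≡x) | inj₂ ydx = inj₂ (inj₂ (inj₁ c≡x) , inj₂ (inj₂ ydx))
... | inj₁ (inj₂ (inj₁ c≡y)) | inj₂ ydx = inj₂ (inj₁ c≡y , inj₂ (inj₂ ydx))
... | inj₁ (inj₂ (inj₂ xcy)) | inj₂ ydx = ⊥-elim (¬cr (inj₁ (xcy , ydx)))
... | inj₂ ycx | inj₁ (inj₁ d≡x) = inj₂ (inj₂ (inj₂ ycx) , inj₂ (inj₁ d≡x))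
... | inj₂ ycx | inj₁ (inj₂ (inj₁ d≡y)) = inj₂ (inj₂ (inj₂ ycx) , inj₁ d≡y)
... | inj₂ ycx | inj₁ (inj₂ (inj₂ xdy)) = ⊥-elim (¬cr (inj₂ (ycx , xdy)))
... | inj₂ ycx | inj₂ ydx = inj₂ (inj₂ (inj₂ ycx) , inj₂ (inj₂ ydx))

Neighbour : DiagPred n → Vtx n → Vtx n → Vtx n → Set
Neighbour f x y r = Between x r y × (r ≡ next x ⊎ Joined f x r)

FarthestNeighbour : DiagPred n → Vtx n → Vtx n → Vtx n → Set
FarthestNeighbour f x y p = Neighbour f x y p × (∀ r → Neighbour f x y r → ¬ Between x p r)

farthestNeighbour : (f : DiagPred n) {x y : Vtx n} → NonAdjacent x y → ∃ (FarthestNeighbour f x y)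
farthestNeighbour f {x} {y} (nonAdjacent x≢y next-x≢y _) =
  let p , neighbour-p , _ , farthest = maximal-above between-trans (λ bt → between⇒≢ʳ bt refl) (between? x) neighbour? (allFin _) next-x
  in p , neighbour-p , λ r neighbour-r → farthest (∈-allFin r) neighbour-r
  where
  next-x : Neighbour f x y (next x)
  next-x = next-between (λ e → x≢y (sym e)) (λ e → next-x≢y (sym e)) , inj₁ refl
  neighbour? : ∀ r → Dec (Neighbour f x y r)
  neighbour? r = between? x r y ×-dec (r ≟ next x ⊎-dec joined? f x r)

module _ {x y p q : Vtx n} (xpy : Between x p y) (yqx : Between y q x) where

  onArc-beyond-p : {w : Vtx n} → OnArc x y w → Between p w q → w ≡ y ⊎ Between p w y
  onArc-beyond-p (inj₁ refl) pwq = ⊥-elim (between-asym pwq (between-rotate⁻¹ (between-trans xpy (between-rotate⁻¹ yqx))))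
  onArc-beyond-p (inj₂ (inj₁ w≡y)) _ = inj₁ w≡y
  onArc-beyond-p {w} (inj₂ (inj₂ xwy)) pwq with between-total (between⇒≢ˡ xwy) (λ e → between⇒≢ˡ pwq (sym e)) (between⇒≢ˡ xpy)
  ... | inj₁ xwp = ⊥-elim (between-asym pwq (between-rotate⁻¹ (between-chain xwp (between-trans xpy (between-rotate⁻¹ yqx)))))
  ... | inj₂ pwx = inj₂ (between-chain (between-rotate⁻¹ pwx) xwy)

  onArc-before-p : {w : Vtx n} → OnArc x y w → Between q w p → w ≡ x ⊎ Between x w p
  onArc-before-p (inj₁ w≡x) _ = inj₁ w≡x
  onArc-before-p (inj₂ (inj₁ refl)) qwp = ⊥-elim (between-asym (between-chain xpy (between-rotate⁻¹ yqx)) qwp)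
  onArc-before-p {w} (inj₂ (inj₂ xwy)) qwp with between-total (between⇒≢ˡ xwy) (between⇒≢ʳ qwp) (between⇒≢ˡ xpy)
  ... | inj₁ xwp = inj₂ xwp
  ... | inj₂ pwx = ⊥-elim (between-asym (between-chain (between-rotate⁻¹ pwx) (between-trans xwy (between-rotate⁻¹ yqx))) qwp)

-- A diagonal uv of f with both ends on the arc [x , y] cannot cross pq: its end beyond p would be a
-- farther neighbour of x, unless its other end lies strictly between x and p, where uv crosses xp.
farthest-noncrossing : {f : DiagPred n} → IsDissection f → {x y p q : Vtx n} → ¬ Joined f x y →
                       FarthestNeighbour f x y p → Between y q x →
                       ∀ {u v} → Joined f u v → OnArc x y u → OnArc x y v → ¬ Crossing p q u v
farthest-noncrossing {f = f} dis {x} {y} {p} {q} ¬xy ((xpy , p-linked) , farthest) yqx j u∈ v∈ (inj₁ (puq , qvp)) =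
  beyond-before j (onArc-beyond-p xpy yqx u∈ puq) (onArc-before-p xpy yqx v∈ qvp)
  where
  beyond-before : ∀ {u v} → Joined f u v → u ≡ y ⊎ Between p u y → v ≡ x ⊎ Between x v p → ⊥
  beyond-before j (inj₁ refl) (inj₁ refl) = ¬xy (joined-sym j)
  beyond-before {u} j (inj₂ puy) (inj₁ refl) =
    farthest u (proj₁ (between-split xpy puy) , inj₂ (joined-sym j)) (proj₂ (between-split xpy puy))
  beyond-before {u} {v} j u-beyond (inj₂ xvp) = joined-noncrossing dis (x-p p-linked) j (inj₂ (pux u-beyond , xvp))
    where
    x-p : p ≡ next x ⊎ Joined f x p → Joined f x p
    x-p (inj₁ refl) = ⊥-elim (¬between-next xvp)
    x-p (inj₂ xp) = xp
    pux : u ≡ y ⊎ Between p u y → Between p u x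
    pux (inj₁ refl) = between-rotate xpy
    pux (inj₂ puy) = between-trans puy (between-rotate xpy)
farthest-noncrossing dis ¬xy farthest yqx j u∈ v∈ (inj₂ (qup , pvq)) =
  farthest-noncrossing dis ¬xy farthest yqx (joined-sym j) v∈ u∈ (inj₁ (pvq , qup))

compatible-crossing-diagonal : {f : DiagPred n} → IsDissection f → {x y : Vtx n} → NonAdjacent x y → ¬ Joined f x y →
       (∀ {c d} → Joined f c d → ¬ Crossing x y c d) →
       ∃ λ p → ∃ λ q → NonAdjacent p q × Crossing x y p q × (∀ {c d} → Joined f c d → ¬ Crossing p q c d)
compatible-crossing-diagonal {f = f} dis {x} {y} xy ¬xy ¬cross = across (farthestNeighbour f xy) (farthestNeighbour f (nonAdjacent-sym xy))
  where
  across : ∃ (FarthestNeighbour f x y) → ∃ (FarthestNeighbour f y x) →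
           ∃ λ p → ∃ λ q → NonAdjacent p q × Crossing x y p q × (∀ {c d} → Joined f c d → ¬ Crossing p q c d)
  across (p , farP@((xpy , _) , _)) (q , farQ@((yqx , _) , _)) =
    p , q , nonAdjacent p≢q next-p≢q next-q≢p , inj₁ (xpy , yqx) , pq-noncrossing
    where
    p≢q : p ≢ q
    p≢q refl = between-asym xpy yqx
    next-p≢q : next p ≢ q
    next-p≢q refl = ¬between-next (between-chain xpy (between-rotate⁻¹ yqx))
    next-q≢p : next q ≢ p
    next-q≢p refl = ¬between-next (between-chain yqx (between-rotate⁻¹ xpy))
    pq-noncrossing : ∀ {c d} → Joined f c d → ¬ Crossing p q c d
    pq-noncrossing j with noncrossing⇒same-side (distinct xy) (¬cross j)
    ... | inj₁ (c∈ , d∈) = farthest-noncrossing dis ¬xy farP yqx j c∈ d∈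
    ... | inj₂ (c∈ , d∈) = λ cr → farthest-noncrossing dis (λ j′ → ¬xy (joined-sym j′)) farQ xpy j c∈ d∈ (crossing-swapˡ cr)

crossing⇒crosses : {f : DiagPred n} → IsDissection f → {x y c d : Vtx n} → T (isDiag n x y) → T (f c d) →
                   Crossing x y c d → T (crosses n x y c d)
crossing⇒crosses dis {x} {y} {c} {d} xy t cr =
  Equivalence.from (crosses⇔⋈ (diagonal x y xy) (diagonal c d (diagonals dis c d t))) (cross cr)

completion-avoids : {g : DiagPred n} → IsDissection g → ∀ {x y c d} → T (g c d) → T (crosses n x y c d) →
                    ¬ T (mem (fromPred (complete g)) x y)
completion-avoids {g = g} dis {x} {y} {c} {d} t cr t′ =
  noncrossing (Equivalence.to (validB⇔ (fromPred (complete g))) (proj₁ (complete-isTriangulation dis))) x y c d t′ (complete-⊇ g c d t) cr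

avoiding-triangulation : {f : DiagPred n} → IsDissection f → {x y : Vtx n} → T (isDiag n x y) → ¬ T (f x y) →
                         ∃ λ Tr → IsTriangulation n Tr × f ⊆ᵖ mem Tr × ¬ T (mem Tr x y)
avoiding-triangulation {n} {f} dis {x} {y} xy ¬fxy with crossesSome? f x y
... | yes (c , d , t , cr) = fromPred (complete f) , complete-isTriangulation dis , complete-⊇ f , completion-avoids dis {x} {y} t cr
... | no ¬cross with compatible-crossing-diagonal dis (lo-hi-nonAdjacent (diagonal x y xy)) ¬joined-xy xy-noncrossing
  where
  ¬joined-xy : ¬ Joined f x y
  ¬joined-xy (forward t) = ¬fxy t
  ¬joined-xy (backward t) = <-asym (lo<hi (diagonal x y xy)) (lo<hi (diagonal y x (diagonals dis y x t)))
  xy-noncrossing : ∀ {c d} → Joined f c d → ¬ Crossing x y c d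
  xy-noncrossing (forward t) cr = ¬cross (_ , _ , t , crossing⇒crosses dis xy t cr)
  xy-noncrossing (backward t) cr = ¬cross (_ , _ , t , crossing⇒crosses dis xy t (crossing-swapʳ cr))
... | p , q , pq , x-y-p-q , pq-noncrossing =
  fromPred (complete f′) , complete-isTriangulation dis′ , (λ a b t → complete-⊇ f′ a b (insert-⊇ {f = f} a b t)) ,
  completion-avoids dis′ {x} {y} new (crossing⇒crosses dis′ xy new x-y-lo-hi)
  where
  flipped : Diagonal n
  flipped = chord p q pq
  ¬crosses-flipped : ¬ CrossesSome f (lo flipped) (hi flipped)
  ¬crosses-flipped (c , c′ , t , cr) = pq-noncrossing (forward t)
    (Equivalence.to (chord-crossing⇔ pq) (crossing (Equivalence.to (crosses⇔⋈ flipped (diagonal c c′ (diagonals dis c c′ t))) cr)))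
  f′ : DiagPred n
  f′ = insert f (lo flipped) (hi flipped)
  dis′ : IsDissection f′
  dis′ = insert-isDissection dis (isDiagonal flipped) ¬crosses-flipped
  new : T (f′ (lo flipped) (hi flipped))
  new = insert-new {f = f}
  x-y-lo-hi : Crossing x y (lo flipped) (hi flipped)
  x-y-lo-hi = crossing-sym (Equivalence.from (chord-crossing⇔ pq) (crossing-sym x-y-p-q))

-- Maps on diagonals

endpoints : Diagonal n → Vtx n × Vtx n
endpoints d = lo d , hi d

endpoints-injective : {d e : Diagonal n} → endpoints d ≡ endpoints e → d ≡ e
endpoints-injective eq = diagonal-≡ (cong proj₁ eq) (cong proj₂ eq)

Pair↔Fin : (Vtx n × Vtx n) ↔ Fin ((3 + n) * (3 + n))
Pair↔Fin = ↔-sym *↔×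

diagonal-injective⇒surjective : (ρ : Diagonal n → Diagonal n) → (∀ {d e} → ρ d ≡ ρ e → d ≡ e) → ∀ e → ∃ λ d → ρ d ≡ e
diagonal-injective⇒surjective {n} ρ ρ-inj e =
  let (a , b) , ab , eq = injectiveOn⇒surjectiveOn Pair↔Fin (λ (a , b) → T? (isDiag n a b)) ρ′
                            (λ {(a , b)} ab → isDiagonal (ρ (diagonal a b ab))) ρ′-inj (isDiagonal e)
  in diagonal a b ab , endpoints-injective eq
  where
  ρ′ : ∀ (ab : Vtx n × Vtx n) → T (isDiag n (proj₁ ab) (proj₂ ab)) → Vtx n × Vtx n
  ρ′ (a , b) ab = endpoints (ρ (diagonal a b ab))
  ρ′-inj : ∀ {x y} p q → ρ′ x p ≡ ρ′ y q → x ≡ y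
  ρ′-inj {a , b} {a′ , b′} p q eq =
    cong endpoints (ρ-inj {diagonal a b p} {diagonal a′ b′ q} (endpoints-injective eq))

-- Counting noncrossing pairs: an injective map on diagonals sends noncrossing pairs onto noncrossing pairs,
-- so it cannot send a crossing pair to a noncrossing one.
noncrossing-preserving⇒crossing-preserving :
  (σ : Diagonal n → Diagonal n) → (∀ {d e} → σ d ≡ σ e → d ≡ e) →
  (∀ {d e} → ¬ d ⋈ e → ¬ σ d ⋈ σ e) → ∀ {d e} → d ⋈ e → σ d ⋈ σ e
noncrossing-preserving⇒crossing-preserving {n} σ σ-inj σ-nc {d} {e} d⋈e with σ d ⋈? σ e
... | yes σd⋈σe = σd⋈σe
... | no σd⋫σe = ⊥-elim (no-preimage (injectiveOn⇒surjectiveOn Quad↔Fin NoncrossingPair? σ² σ²-closed σ²-inj image-noncrossing))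
  where
  Quad : Set
  Quad = (Vtx n × Vtx n) × (Vtx n × Vtx n)
  Quad↔Fin : Quad ↔ Fin (((3 + n) * (3 + n)) * ((3 + n) * (3 + n)))
  Quad↔Fin = ↔-trans (Pair↔Fin ×-↔ Pair↔Fin) (↔-sym *↔×)
  NoncrossingPair : Quad → Set
  NoncrossingPair ((a , b) , (c , d)) = T (isDiag n a b) × T (isDiag n c d) × ¬ T (crosses n a b c d)
  NoncrossingPair? : ∀ q → Dec (NoncrossingPair q)
  NoncrossingPair? ((a , b) , (c , d)) = T? (isDiag n a b) ×-dec T? (isDiag n c d) ×-dec ¬? (T? (crosses n a b c d))
  σ² : ∀ q → NoncrossingPair q → Quad
  σ² ((a , b) , (c , d)) (ab , cd , _) = endpoints (σ (diagonal a b ab)) , endpoints (σ (diagonal c d cd))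
  σ²-closed : ∀ {q} (p : NoncrossingPair q) → NoncrossingPair (σ² q p)
  σ²-closed {(a , b) , (c , d)} (ab , cd , ¬cross) =
    isDiagonal (σ (diagonal a b ab)) , isDiagonal (σ (diagonal c d cd)) ,
    λ cr → σ-nc (λ x → ¬cross (Equivalence.from (crosses⇔⋈ (diagonal a b ab) (diagonal c d cd)) x))
                (Equivalence.to (crosses⇔⋈ (σ (diagonal a b ab)) (σ (diagonal c d cd))) cr)
  image-noncrossing : NoncrossingPair (endpoints (σ d) , endpoints (σ e))
  image-noncrossing = isDiagonal (σ d) , isDiagonal (σ e) , λ cr → σd⋫σe (Equivalence.to (crosses⇔⋈ (σ d) (σ e)) cr)
  no-preimage : (∃ λ q → Σ (NoncrossingPair q) λ p → σ² q p ≡ (endpoints (σ d) , endpoints (σ e))) → ⊥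
  no-preimage (((a , b) , (c , c′)) , (ab , cc′ , ¬cross) , eq) =
    ¬cross (Equivalence.from (crosses⇔⋈ (diagonal a b ab) (diagonal c c′ cc′)) (subst₂ _⋈_ (sym d≡) (sym e≡) d⋈e))
    where
    d≡ : diagonal a b ab ≡ d
    d≡ = σ-inj (endpoints-injective (cong proj₁ eq))
    e≡ : diagonal c c′ cc′ ≡ e
    e≡ = σ-inj (endpoints-injective (cong proj₂ eq))
  σ²-inj : ∀ {q q′} p p′ → σ² q p ≡ σ² q′ p′ → q ≡ q′
  σ²-inj {(a , b) , (c , d)} {(a′ , b′) , (c′ , d′)} (ab , cd , _) (ab′ , cd′ , _) eq =
    cong₂ _,_ (cong endpoints (σ-inj {diagonal a b ab} {diagonal a′ b′ ab′} (endpoints-injective (cong proj₁ eq))))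
              (cong endpoints (σ-inj {diagonal c d cd} {diagonal c′ d′ cd′} (endpoints-injective (cong proj₂ eq))))

-- The face poset

face-≡ : (S S′ : DiagSet n) (p : T (validB n S)) (p′ : T (validB n S′)) → S ⊆D S′ → S′ ⊆D S → face S p ≡ face S′ p′
face-≡ S S′ p p′ S⊆S′ S′⊆S with DiagSet-ext {S = S} {S′} (λ a b → T-injective {mem S a b} {mem S′ a b} (S⊆S′ a b) (S′⊆S a b))
... | refl = cong (face S) (T-irrelevant p p′)

⊇⇒≤F : (S S′ : DiagSet n) (p : T (validB n S)) (p′ : T (validB n S′)) → S′ ⊆D S → face S p ≤F face S′ p′
⊇⇒≤F S S′ p p′ S′⊆S Tr _ S⊆Tr a b t = S⊆Tr a b (S′⊆S a b t)

≤F⇒⊇ : (S S′ : DiagSet n) (p : T (validB n S)) (p′ : T (validB n S′)) → face S p ≤F face S′ p′ → S′ ⊆D S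
≤F⇒⊇ {n} S S′ p p′ S≤S′ a b t with T? (mem S a b)
... | yes s = s
... | no ¬s with avoiding-triangulation (Equivalence.to (validB⇔ S) p) (diagonals (Equivalence.to (validB⇔ S′) p′) a b t) ¬s
...   | Tr , tri , S⊆Tr , ¬Tr-ab = ⊥-elim (¬Tr-ab (S≤S′ Tr tri S⊆Tr a b t))

¬face≤Fbot : (S : DiagSet n) (p : T (validB n S)) → ¬ (face S p ≤F bot)
¬face≤Fbot S p S≤bot = S≤bot (fromPred (complete (mem S))) (complete-isTriangulation dis) (complete-⊇ (mem S))
  where dis = Equivalence.to (validB⇔ S) p

bot≤F : (F : Face n) → bot ≤F F
bot≤F F Tr _ ()

≤F-antisym : {F G : Face n} → F ≤F G → G ≤F F → F ≡ G
≤F-antisym {F = bot} {bot} _ _ = refl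
≤F-antisym {F = bot} {face S p} _ G≤F = ⊥-elim (¬face≤Fbot S p G≤F)
≤F-antisym {F = face S p} {bot} F≤G _ = ⊥-elim (¬face≤Fbot S p F≤G)
≤F-antisym {F = face S p} {face S′ p′} F≤G G≤F = face-≡ S S′ p p′ (≤F⇒⊇ S′ S p′ p G≤F) (≤F⇒⊇ S S′ p p′ F≤G)

members : Face n → Vtx n → Vtx n → Bool
members bot _ _ = false
members (face S _) = mem S

fromPred-validB : {f : DiagPred n} → IsDissection f → T (validB n (fromPred f))
fromPred-validB {f = f} dis = Equivalence.from (validB⇔ (fromPred f)) (isDissection-cong (λ a b → sym (mem-fromPred f a b)) dis)

faceOf : (f : DiagPred n) → IsDissection f → Face n
faceOf f dis = face (fromPred f) (fromPred-validB dis)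

∅ᵖ : DiagPred n
∅ᵖ _ _ = false

∅ᵖ-isDissection : IsDissection (∅ᵖ {n})
∅ᵖ-isDissection = record { diagonals = λ _ _ () ; noncrossing = λ _ _ _ _ () }

∅ˢ : DiagSet n
∅ˢ = fromPred ∅ᵖ

∅ˢ-valid : T (validB n ∅ˢ)
∅ˢ-valid {n} = fromPred-validB (∅ᵖ-isDissection {n})

∅ˢ-empty : ∀ a b → ¬ T (mem (∅ˢ {n}) a b)
∅ˢ-empty a b t = subst T (mem-fromPred ∅ᵖ a b) t

top : Face n
top {n} = face ∅ˢ (∅ˢ-valid {n})

≤F-top : (F : Face n) → F ≤F top
≤F-top bot = bot≤F top
≤F-top {n} (face S p) = ⊇⇒≤F S ∅ˢ p (∅ˢ-valid {n}) λ a b t → ⊥-elim (∅ˢ-empty a b t)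

empty⇒≡top : (S : DiagSet n) (p : T (validB n S)) → (∀ a b → ¬ T (mem S a b)) → face S p ≡ top
empty⇒≡top {n} S p empty = face-≡ S ∅ˢ p (∅ˢ-valid {n}) (λ a b t → ⊥-elim (empty a b t)) (λ a b t → ⊥-elim (∅ˢ-empty a b t))

singleton : Diagonal n → DiagPred n
singleton d = insert ∅ᵖ (lo d) (hi d)

singleton-isDissection : (d : Diagonal n) → IsDissection (singleton d)
singleton-isDissection d = insert-isDissection ∅ᵖ-isDissection (isDiagonal d) λ { (_ , _ , () , _) }

⟦_⟧ : Diagonal n → DiagSet n
⟦ d ⟧ = fromPred (singleton d)

⟦⟧-valid : (d : Diagonal n) → T (validB n ⟦ d ⟧)
⟦⟧-valid d = fromPred-validB (singleton-isDissection d)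

∈⟦⟧ : (d : Diagonal n) → ∀ {a b} → T (mem ⟦ d ⟧ a b) → a ≡ lo d × b ≡ hi d
∈⟦⟧ d {a} {b} t with insert-cases {f = ∅ᵖ} (subst T (mem-fromPred (singleton d) a b) t)
... | inj₂ ab = ab

lo-hi∈⟦⟧ : (d : Diagonal n) → T (mem ⟦ d ⟧ (lo d) (hi d))
lo-hi∈⟦⟧ d = subst T (sym (mem-fromPred (singleton d) (lo d) (hi d))) (insert-new {f = ∅ᵖ} {lo d} {hi d})

⟦⟧-⊆ : (S : DiagSet n) (d : Diagonal n) → T (mem S (lo d) (hi d)) → ⟦ d ⟧ ⊆D S
⟦⟧-⊆ S d t a b u with ∈⟦⟧ d {a} {b} u
... | refl , refl = t

⊆⟦⟧ : (S : DiagSet n) (d : Diagonal n) → S ⊆D ⟦ d ⟧ → ∀ a b → T (mem S a b) → T (mem S (lo d) (hi d))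
⊆⟦⟧ S d S⊆d a b t with ∈⟦⟧ d {a} {b} (S⊆d a b t)
... | refl , refl = t

-- Opaque, so that comparing two facets never unfolds the validity proofs inside them.
opaque
  facetOf : Diagonal n → Face n
  facetOf d = face ⟦ d ⟧ (⟦⟧-valid d)

Coatom : Face n → Set
Coatom F = F ≢ top × (∀ G → F ≤F G → G ≡ F ⊎ G ≡ top)

opaque
  unfolding facetOf

  facetOf-face : (d : Diagonal n) → facetOf d ≡ face ⟦ d ⟧ (⟦⟧-valid d)
  facetOf-face d = refl

  face≤facetOf : (S : DiagSet n) (p : T (validB n S)) (d : Diagonal n) → T (mem S (lo d) (hi d)) → face S p ≤F facetOf d
  face≤facetOf S p d t = ⊇⇒≤F S ⟦ d ⟧ p (⟦⟧-valid d) (⟦⟧-⊆ S d t)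

  ≤facetOf⇒∈ : (S : DiagSet n) (p : T (validB n S)) (d : Diagonal n) → face S p ≤F facetOf d → T (mem S (lo d) (hi d))
  ≤facetOf⇒∈ S p d S≤d = ≤F⇒⊇ S ⟦ d ⟧ p (⟦⟧-valid d) S≤d (lo d) (hi d) (lo-hi∈⟦⟧ d)

  facetOf-injective : {d e : Diagonal n} → facetOf d ≡ facetOf e → d ≡ e
  facetOf-injective {d = d} {e} eq with ∈⟦⟧ e (subst (λ F → T (members F (lo d) (hi d))) eq (lo-hi∈⟦⟧ d))
  ... | lo≡ , hi≡ = diagonal-≡ lo≡ hi≡

  facetOf≢bot : (d : Diagonal n) → facetOf d ≢ bot
  facetOf≢bot d ()

  facetOf≢top : (d : Diagonal n) → facetOf d ≢ top
  facetOf≢top d eq = ∅ˢ-empty (lo d) (hi d) (subst (λ F → T (members F (lo d) (hi d))) eq (lo-hi∈⟦⟧ d))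

  facetOf-coatom : (d : Diagonal n) → Coatom (facetOf d)
  facetOf-coatom d = facetOf≢top d , above
    where
    above : ∀ G → facetOf d ≤F G → G ≡ facetOf d ⊎ G ≡ top
    above bot d≤bot = ⊥-elim (¬face≤Fbot ⟦ d ⟧ (⟦⟧-valid d) d≤bot)
    above (face S p) d≤S = decide (T? (mem S (lo d) (hi d)))
      where
      S⊆d : S ⊆D ⟦ d ⟧
      S⊆d = ≤F⇒⊇ ⟦ d ⟧ S (⟦⟧-valid d) p d≤S
      decide : Dec (T (mem S (lo d) (hi d))) → face S p ≡ facetOf d ⊎ face S p ≡ top
      decide (yes t) = inj₁ (face-≡ S ⟦ d ⟧ p (⟦⟧-valid d) S⊆d (⟦⟧-⊆ S d t))
      decide (no ¬t) = inj₂ (empty⇒≡top S p λ a b u → ¬t (⊆⟦⟧ S d S⊆d a b u))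

coatom⇒facetOf : (S : DiagSet n) (p : T (validB n S)) → Coatom (face S p) → ∃ λ d → face S p ≡ facetOf d
coatom⇒facetOf {n} S p (S≢top , maximal) = pick (any? λ a → any? λ b → T? (mem S a b))
  where
  below : (d : Diagonal n) → facetOf d ≡ face S p ⊎ facetOf d ≡ top → ∃ λ d → face S p ≡ facetOf d
  below d (inj₁ e) = d , sym e
  below d (inj₂ e) = ⊥-elim (facetOf≢top d e)
  pick : Dec (∃ λ a → ∃ λ b → T (mem S a b)) → ∃ λ d → face S p ≡ facetOf d
  pick (no empty) = ⊥-elim (S≢top (empty⇒≡top S p λ a b t → empty (a , b , t)))
  pick (yes (a , b , t)) = below d (maximal (facetOf d) (face≤facetOf S p d t))
    where
    d : Diagonal n
    d = diagonal a b (diagonals (Equivalence.to (validB⇔ S) p) a b t)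

lowerBound⇒noncrossing : (F : Face n) → F ≢ bot → {d e : Diagonal n} → F ≤F facetOf d → F ≤F facetOf e → ¬ d ⋈ e
lowerBound⇒noncrossing bot F≢bot = ⊥-elim (F≢bot refl)
lowerBound⇒noncrossing {n} (face S p) _ {d} {e} F≤d F≤e d⋈e =
  noncrossing (Equivalence.to (validB⇔ S) p) (lo d) (hi d) (lo e) (hi e) (≤facetOf⇒∈ S p d F≤d) (≤facetOf⇒∈ S p e F≤e)
    (Equivalence.from (crosses⇔⋈ d e) d⋈e)

pair : Diagonal n → Diagonal n → DiagPred n
pair d e = insert (singleton d) (lo e) (hi e)

pair-isDissection : (d e : Diagonal n) → ¬ d ⋈ e → IsDissection (pair d e)
pair-isDissection {n} d e d⋫e = insert-isDissection (singleton-isDissection d) (isDiagonal e) e-crosses-nothing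
  where
  e-crosses-nothing : ¬ CrossesSome (singleton d) (lo e) (hi e)
  e-crosses-nothing (c , c′ , t , cr) with insert-cases {f = ∅ᵖ} {lo d} {hi d} {c} {c′} t
  ... | inj₂ (refl , refl) = d⋫e (⋈-sym (Equivalence.to (crosses⇔⋈ e d) cr))

pairFace : (d e : Diagonal n) → ¬ d ⋈ e → Face n
pairFace d e d⋫e = faceOf (pair d e) (pair-isDissection d e d⋫e)

pairFace≤facetOfˡ : (d e : Diagonal n) (d⋫e : ¬ d ⋈ e) → pairFace d e d⋫e ≤F facetOf d
pairFace≤facetOfˡ d e d⋫e = face≤facetOf (fromPred (pair d e)) (fromPred-validB (pair-isDissection d e d⋫e)) d
  (subst T (sym (mem-fromPred (pair d e) (lo d) (hi d))) (insert-⊇ {f = singleton d} (lo d) (hi d) (insert-new {f = ∅ᵖ} {lo d} {hi d})))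

pairFace≤facetOfʳ : (d e : Diagonal n) (d⋫e : ¬ d ⋈ e) → pairFace d e d⋫e ≤F facetOf e
pairFace≤facetOfʳ d e d⋫e = face≤facetOf (fromPred (pair d e)) (fromPred-validB (pair-isDissection d e d⋫e)) e
  (subst T (sym (mem-fromPred (pair d e) (lo e) (hi e))) (insert-new {f = singleton d} {lo e} {hi e}))

-- Automorphisms act on the diagonals

module _ {n : ℕ} (γ : Automorphism n) where

  γ-injective : ∀ {F G} → to γ F ≡ to γ G → F ≡ G
  γ-injective = Bijection.injective (bij γ)

  γ-surjective : ∀ G → ∃ λ F → to γ F ≡ G
  γ-surjective = Bijection.strictlySurjective (bij γ)

  γ-bot : to γ bot ≡ bot
  γ-bot = least (γ-surjective bot)
    where
    least : (∃ λ F → to γ F ≡ bot) → to γ bot ≡ bot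
    least (F , γF≡bot) = ≤F-antisym (subst (to γ bot ≤F_) γF≡bot (mono γ bot F (bot≤F F))) (bot≤F (to γ bot))

  γ-top : to γ top ≡ top
  γ-top = greatest (γ-surjective top)
    where
    greatest : (∃ λ F → to γ F ≡ top) → to γ top ≡ top
    greatest (F , γF≡top) = ≤F-antisym (≤F-top (to γ top)) (subst (_≤F to γ top) γF≡top (mono γ F top (≤F-top F)))

  γ≢bot : ∀ S p → to γ (face S p) ≢ bot
  γ≢bot S p eq = face≢bot (γ-injective (trans eq (sym γ-bot)))
    where
    face≢bot : face S p ≢ bot
    face≢bot ()

  coatom-preimage : ∀ H → Coatom (to γ H) → Coatom H
  coatom-preimage H (γH≢top , maximal) = (λ e → γH≢top (trans (cong (to γ) e) γ-top)) , above
    where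
    preimage : ∀ {G} → to γ G ≡ to γ H ⊎ to γ G ≡ top → G ≡ H ⊎ G ≡ top
    preimage (inj₁ e) = inj₁ (γ-injective e)
    preimage (inj₂ e) = inj₂ (γ-injective (trans e (sym γ-top)))
    above : ∀ G → H ≤F G → G ≡ H ⊎ G ≡ top
    above G H≤G = preimage (maximal (to γ G) (mono γ H G H≤G))

  facet-preimage : ∀ d → ∃ λ e → to γ (facetOf e) ≡ facetOf d
  facet-preimage d = preimage (γ-surjective (facetOf d))
    where
    facet : ∀ {F} → to γ F ≡ facetOf d → (∃ λ e → F ≡ facetOf e) → ∃ λ e → to γ (facetOf e) ≡ facetOf d
    facet γF≡d (e , F≡e) = e , trans (cong (to γ) (sym F≡e)) γF≡d
    preimage : (∃ λ F → to γ F ≡ facetOf d) → ∃ λ e → to γ (facetOf e) ≡ facetOf d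
    preimage (bot , eq) = ⊥-elim (facetOf≢bot d (trans (sym eq) γ-bot))
    preimage (face S p , eq) = facet eq (coatom⇒facetOf S p (coatom-preimage (face S p) (subst Coatom (sym eq) (facetOf-coatom d))))

  abstract
    -- γ maps facets onto facets, since preimages of facets are facets and there are finitely many.
    -- Abstract, so that the counting argument is never unfolded.
    facet-image : ∀ d → ∃ λ e → to γ (facetOf d) ≡ facetOf e
    facet-image d = image (diagonal-injective⇒surjective ρ ρ-injective d)
      where
      ρ : Diagonal n → Diagonal n
      ρ d = proj₁ (facet-preimage d)
      ρ-injective : ∀ {d e} → ρ d ≡ ρ e → d ≡ e
      ρ-injective {d} {e} eq = facetOf-injective
        (trans (sym (proj₂ (facet-preimage d))) (trans (cong (λ d → to γ (facetOf d)) eq) (proj₂ (facet-preimage e))))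
      image : (∃ λ e → ρ e ≡ d) → ∃ λ e → to γ (facetOf d) ≡ facetOf e
      image (e , ρe≡d) = e , trans (cong (λ d → to γ (facetOf d)) (sym ρe≡d)) (proj₂ (facet-preimage e))

  σ : Diagonal n → Diagonal n
  σ d = proj₁ (facet-image d)

  γ-facetOf : ∀ d → to γ (facetOf d) ≡ facetOf (σ d)
  γ-facetOf d = proj₂ (facet-image d)

  σ-injective : ∀ {d e} → σ d ≡ σ e → d ≡ e
  σ-injective {d} {e} eq = facetOf-injective (γ-injective (trans (γ-facetOf d) (trans (cong facetOf eq) (sym (γ-facetOf e)))))

  σ-surjective : ∀ e → ∃ λ d → σ d ≡ e
  σ-surjective e = proj₁ (facet-preimage e) , facetOf-injective (trans (sym (γ-facetOf (proj₁ (facet-preimage e)))) (proj₂ (facet-preimage e)))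

  σ-noncrossing : ∀ {d e} → ¬ d ⋈ e → ¬ σ d ⋈ σ e
  σ-noncrossing {d} {e} d⋫e = lowerBound⇒noncrossing (to γ P) (γ≢bot _ _)
    (subst (to γ P ≤F_) (γ-facetOf d) (mono γ P (facetOf d) (pairFace≤facetOfˡ d e d⋫e)))
    (subst (to γ P ≤F_) (γ-facetOf e) (mono γ P (facetOf e) (pairFace≤facetOfʳ d e d⋫e)))
    where
    P : Face n
    P = pairFace d e d⋫e

  σ-crossing : ∀ {d e} → d ⋈ e → σ d ⋈ σ e
  σ-crossing = noncrossing-preserving⇒crossing-preserving σ σ-injective σ-noncrossing

  module _ (fixes-facets : ∀ d → to γ (facetOf d) ≡ facetOf d) where

    γ-⊇ : (S S′ : DiagSet n) (p : T (validB n S)) (p′ : T (validB n S′)) → to γ (face S p) ≡ face S′ p′ → S ⊆D S′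
    γ-⊇ S S′ p p′ eq a b t = ≤facetOf⇒∈ S′ p′ d (subst₂ _≤F_ eq (fixes-facets d) (mono γ _ _ (face≤facetOf S p d t)))
      where
      d : Diagonal n
      d = diagonal a b (diagonals (Equivalence.to (validB⇔ S) p) a b t)

    -- A triangulation is a maximal dissection, so it is not contained in any other one.
    fixes-triangulation : (Tr : DiagSet n) (tri : IsTriangulation n Tr) → to γ (face Tr (proj₁ tri)) ≡ face Tr (proj₁ tri)
    fixes-triangulation Tr tri@(valid , maximal) = image (to γ (face Tr valid)) refl
      where
      image : ∀ G → to γ (face Tr valid) ≡ G → G ≡ face Tr valid
      image bot eq = ⊥-elim (γ≢bot Tr valid eq)
      image (face X q) eq = face-≡ X Tr q valid X⊆Tr Tr⊆X
        where
        Tr⊆X : Tr ⊆D X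
        Tr⊆X = γ-⊇ Tr X valid q eq
        X⊆Tr : X ⊆D Tr
        X⊆Tr c d t with T? (mem Tr c d)
        ... | yes u = u
        ... | no ¬u with maximal c d (diagonals (Equivalence.to (validB⇔ X) q) c d t)
        ...   | inj₁ u = ⊥-elim (¬u u)
        ...   | inj₂ (c′ , d′ , u , cr) = ⊥-elim (noncrossing (Equivalence.to (validB⇔ X) q) c d c′ d′ t (Tr⊆X c′ d′ u) cr)

    fixes-faces : ∀ F → to γ F ≡ F
    fixes-faces bot = γ-bot
    fixes-faces (face S p) = image (to γ (face S p)) refl
      where
      image : ∀ G → to γ (face S p) ≡ G → G ≡ face S p
      image bot eq = ⊥-elim (γ≢bot S p eq)
      image (face S′ p′) eq = face-≡ S′ S p′ p (≤F⇒⊇ S S′ p p′ S≤S′) (γ-⊇ S S′ p p′ eq)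
        where
        S≤S′ : face S p ≤F face S′ p′
        S≤S′ Tr tri S⊆Tr = ≤F⇒⊇ Tr S′ (proj₁ tri) p′
          (subst₂ _≤F_ (fixes-triangulation Tr tri) eq (mono γ _ _ (⊇⇒≤F Tr S (proj₁ tri) p S⊆Tr)))

-- Ears

nextⁱ : ℕ → Vtx n → Vtx n
nextⁱ zero v = v
nextⁱ (suc i) v = next (nextⁱ i v)

nextⁱ≡+ᵥ : ∀ i (v : Vtx n) → nextⁱ i v ≡ v +ᵥ i
nextⁱ≡+ᵥ zero v = sym (trans (cong vertex (ℕ.+-identityʳ (toℕ v))) (vertex-toℕ v))
nextⁱ≡+ᵥ (suc i) v = trans (cong next (nextⁱ≡+ᵥ i v)) (trans (+ᵥ-assoc v i 1) (cong (v +ᵥ_) (ℕ.+-comm i 1)))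

nextⁱ-reaches : (v w : Vtx n) → ∃ λ i → nextⁱ i v ≡ w
nextⁱ-reaches v w = proj₁ (+ᵥ-reaches v w) , trans (nextⁱ≡+ᵥ _ v) (proj₂ (+ᵥ-reaches v w))

nextⁱ-≢ : 2 ≤ n → ∀ i (v : Vtx n) → 0 ℕ.< i → i ℕ.< 5 → nextⁱ i v ≢ v
nextⁱ-≢ 2≤n i v 0<i i<5 e = +ᵥ-≢ v 0<i (<-≤-trans i<5 (s≤s (s≤s (s≤s 2≤n)))) (trans (sym (nextⁱ≡+ᵥ i v)) e)

between-ear⇒next : {u w : Vtx n} → Between u w (next (next u)) → w ≡ next u
between-ear⇒next {u = u} {w} bt with w ≟ next u
... | yes e = e
... | no w≢next = ⊥-elim (¬between-next (between-next⇒between bt w≢next))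

module _ {n : ℕ} (2≤n : 2 ≤ n) where

  private
    next²-≢ : (v : Vtx n) → next (next v) ≢ v
    next²-≢ v = nextⁱ-≢ 2≤n 2 v (s≤s z≤n) (s≤s (s≤s (s≤s z≤n)))
    next³-≢ : (v : Vtx n) → next (next (next v)) ≢ v
    next³-≢ v = nextⁱ-≢ 2≤n 3 v (s≤s z≤n) (s≤s (s≤s (s≤s (s≤s z≤n))))
    next⁴-≢ : (v : Vtx n) → next (next (next (next v))) ≢ v
    next⁴-≢ v = nextⁱ-≢ 2≤n 4 v (s≤s z≤n) (s≤s (s≤s (s≤s (s≤s (s≤s z≤n)))))

  next-between-ear : (u : Vtx n) → Between u (next u) (next (next u))
  next-between-ear u = next-between (next²-≢ u) (next-≢ (next u))

  outside-ear : {u w : Vtx n} → w ≢ u → w ≢ next u → w ≢ next (next u) → Between (next (next u)) w u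
  outside-ear {u} {w} w≢u w≢next w≢next² with between-total (λ e → w≢u (sym e)) w≢next² (λ e → next²-≢ u (sym e))
  ... | inj₁ bt = ⊥-elim (w≢next (between-ear⇒next bt))
  ... | inj₂ bt = bt

  ear-nonAdjacent : (u : Vtx n) → NonAdjacent u (next (next u))
  ear-nonAdjacent u = nonAdjacent (λ e → next²-≢ u (sym e)) (λ e → next-≢ (next u) (sym e)) (next³-≢ u)

  -- The ear at u: the diagonal cutting off the vertex next u.
  ear : Vtx n → Diagonal n
  ear u = chord u (next (next u)) (ear-nonAdjacent u)

  ear-crossing⇔ : (u : Vtx n) {c d : Vtx n} → Crossing (lo (ear u)) (hi (ear u)) c d ⇔ Crossing u (next (next u)) c d
  ear-crossing⇔ u = chord-crossing⇔ (ear-nonAdjacent u)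

  ear⋈⇔endpoint : (u : Vtx n) (e : Diagonal n) → ear u ⋈ e ⇔ Endpoint (next u) e
  ear⋈⇔endpoint u e = mk⇔ forth back
    where
    forth : ear u ⋈ e → Endpoint (next u) e
    forth cr with Equivalence.to (ear-crossing⇔ u) (crossing cr)
    ... | inj₁ (ule , _) = inj₁ (sym (between-ear⇒next {u = u} ule))
    ... | inj₂ (_ , uhe) = inj₂ (sym (between-ear⇒next {u = u} uhe))
    e-nonAdjacent : NonAdjacent (lo e) (hi e)
    e-nonAdjacent = lo-hi-nonAdjacent e
    back : Endpoint (next u) e → ear u ⋈ e
    back (inj₁ refl) = cross (Equivalence.from (ear-crossing⇔ u) (inj₁ (next-between-ear u , outside-ear hi≢u hi≢next hi≢next²)))
      where
      hi≢u : hi e ≢ u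
      hi≢u refl = nextʳ≢ e-nonAdjacent refl
      hi≢next : hi e ≢ next u
      hi≢next e′ = distinct e-nonAdjacent (sym e′)
      hi≢next² : hi e ≢ next (next u)
      hi≢next² e′ = nextˡ≢ e-nonAdjacent (sym e′)
    back (inj₂ refl) = cross (Equivalence.from (ear-crossing⇔ u) (inj₂ (outside-ear lo≢u lo≢next lo≢next² , next-between-ear u)))
      where
      lo≢u : lo e ≢ u
      lo≢u refl = nextˡ≢ e-nonAdjacent refl
      lo≢next : lo e ≢ next u
      lo≢next = distinct e-nonAdjacent
      lo≢next² : lo e ≢ next (next u)
      lo≢next² e′ = nextʳ≢ e-nonAdjacent (sym e′)

  ear-between : (v : Vtx n) → ear (next (next v)) ⋈ ear (next v) × (∀ s → s ⋈ ear v → s ⋈ ear (next (next v)) → s ≡ ear (next v))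
  ear-between v =
    ⋈-sym (Equivalence.from (ear⋈⇔endpoint (next v) (ear (next (next v)))) (chord-endpointˡ (ear-nonAdjacent (next (next v))))) ,
    λ s s⋈v s⋈v² → ≡chord (ear-nonAdjacent (next v)) (Equivalence.to (ear⋈⇔endpoint v s) (⋈-sym s⋈v))
                                                      (Equivalence.to (ear⋈⇔endpoint (next (next v)) s) (⋈-sym s⋈v²))

  module _ (v : Vtx n) where

    private
      v¹ v² v³ v⁴ : Vtx n
      v¹ = next v
      v² = next v¹
      v³ = next v²
      v⁴ = next v³

    long : NonAdjacent v¹ v⁴
    long = nonAdjacent (λ e → next³-≢ v¹ (sym e)) (λ e → next²-≢ v² (sym e)) (next⁴-≢ v¹)

    long⋈ : ∀ {z} (p : NonAdjacent v² z) → z ≢ v⁴ → chord v¹ v⁴ long ⋈ chord v² z p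
    long⋈ {z} p z≢v⁴ = chord-⋈-chord (inj₁ (next-between (next³-≢ v¹) (next²-≢ v²) , z-outside))
      where
      z-outside : Between v⁴ z v¹
      z-outside with between-total (λ e → nextʳ≢ p (cong next (sym e))) z≢v⁴ (λ e → next³-≢ v¹ (sym e))
      ... | inj₁ v¹zv⁴ = ⊥-elim (¬between-next (between-next⇒between (between-next⇒between v¹zv⁴ (λ e → nextˡ≢ p (sym e)))
                                                                       (λ e → distinct p (sym e))))
      ... | inj₂ v⁴zv¹ = v⁴zv¹

    long≢ear : chord v¹ v⁴ long ≢ ear v¹
    long≢ear eq with endpoint-chord (ear-nonAdjacent v¹) (subst (Endpoint v⁴) eq (chord-endpointʳ long))
    ... | inj₁ e = next³-≢ v¹ e
    ... | inj₂ e = next-≢ v³ e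

    -- t has the endpoint next² v; were its other end not next⁴ v, the long chord would cross both ear v and t.
    ear-unique : (t : Diagonal n) → t ⋈ ear v¹ → (∀ s → s ⋈ ear v → s ⋈ t → s ≡ ear v¹) → t ≡ ear v²
    ear-unique t t⋈v¹ unique = other-end (≡chord-from t (Equivalence.to (ear⋈⇔endpoint v¹ t) (⋈-sym t⋈v¹)))
      where
      other-end : (∃ λ z → Σ (NonAdjacent v² z) λ p → t ≡ chord v² z p) → t ≡ ear v²
      other-end (z , p , t≡) with z ≟ v⁴
      ... | yes refl = ≡chord (ear-nonAdjacent v²) (subst (Endpoint v²) (sym t≡) (chord-endpointˡ p))
                                                 (subst (Endpoint v⁴) (sym t≡) (chord-endpointʳ p))
      ... | no z≢v⁴ = ⊥-elim (long≢ear (unique (chord v¹ v⁴ long)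
                                                (⋈-sym (Equivalence.from (ear⋈⇔endpoint v (chord v¹ v⁴ long)) (chord-endpointˡ long)))
                                                (subst (chord v¹ v⁴ long ⋈_) (sym t≡) (long⋈ p z≢v⁴))))

  module _ (σ : Diagonal n → Diagonal n) (σ-surjective : ∀ e → ∃ λ d → σ d ≡ e)
           (σ-crossing : ∀ {d e} → d ⋈ e → σ d ⋈ σ e) (σ-noncrossing : ∀ {d e} → ¬ d ⋈ e → ¬ σ d ⋈ σ e) where

    Fixed : Diagonal n → Set
    Fixed d = σ d ≡ d

    fixed-ear-step : ∀ v → Fixed (ear v) → Fixed (ear (next v)) → Fixed (ear (next (next v)))
    fixed-ear-step v fixed⁰ fixed¹ = ear-unique v (σ (ear (next (next v)))) t⋈v¹ unique
      where
      t⋈v¹ : σ (ear (next (next v))) ⋈ ear (next v)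
      t⋈v¹ = subst (σ (ear (next (next v))) ⋈_) fixed¹ (σ-crossing (proj₁ (ear-between v)))
      reflect : ∀ {d e} → σ d ⋈ σ e → d ⋈ e
      reflect {d} {e} = decidable-stable (d ⋈? e) ∘′ flip σ-noncrossing
      unique : ∀ s → s ⋈ ear v → s ⋈ σ (ear (next (next v))) → s ≡ ear (next v)
      unique s s⋈v⁰ s⋈t with σ-surjective s
      ... | s′ , refl = trans (cong σ (proj₂ (ear-between v) s′ (reflect (subst (σ s′ ⋈_) (sym fixed⁰) s⋈v⁰)) (reflect s⋈t))) fixed¹

    fixed-ears : ∀ w → Fixed (ear w) → Fixed (ear (next w)) → ∀ v → Fixed (ear v)
    fixed-ears w fixed⁰ fixed¹ v = reach (nextⁱ-reaches w v)
      where
      fixed-from : ∀ i → Fixed (ear (nextⁱ i w)) × Fixed (ear (nextⁱ (suc i) w))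
      fixed-from zero = fixed⁰ , fixed¹
      fixed-from (suc i) = step (fixed-from i)
        where
        step : Fixed (ear (nextⁱ i w)) × Fixed (ear (nextⁱ (suc i) w)) → Fixed (ear (nextⁱ (suc i) w)) × Fixed (ear (nextⁱ (2 + i) w))
        step (f⁰ , f¹) = f¹ , fixed-ear-step (nextⁱ i w) f⁰ f¹
      reach : (∃ λ i → nextⁱ i w ≡ v) → Fixed (ear v)
      reach (i , refl) = proj₁ (fixed-from i)

    -- Every endpoint a of d is the tip of the ear at prev a, which d crosses; so a is also an endpoint of σ d.
    fixed-all : ∀ w → Fixed (ear w) → Fixed (ear (next w)) → ∀ d → Fixed d
    fixed-all w fixed⁰ fixed¹ d = sym (diagonal-≡-endpoints (endpoint-σ (inj₁ refl)) (endpoint-σ (inj₂ refl)))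
      where
      endpoint-σ : ∀ {a} → Endpoint a d → Endpoint a (σ d)
      endpoint-σ {a} a∈d = subst (λ a → Endpoint a (σ d)) (next-prev a)
        (Equivalence.to (ear⋈⇔endpoint (prev a) (σ d))
          (⋈-sym (subst (σ d ⋈_) (fixed-ears w fixed⁰ fixed¹ (prev a))
            (σ-crossing (⋈-sym (Equivalence.from (ear⋈⇔endpoint (prev a) d) (subst (λ a → Endpoint a d) (sym (next-prev a)) a∈d)))))))

⟦⟧-by-toℕ : (e : Diagonal n) {l h : ℕ} → toℕ (lo e) ≡ l → toℕ (hi e) ≡ h →
            fromPred (λ a b → (toℕ a ℕ.≡ᵇ l) ∧ (toℕ b ℕ.≡ᵇ h)) ≡ ⟦ e ⟧
⟦⟧-by-toℕ {n} e {l} {h} lo≡l hi≡h = DiagSet-ext λ a b →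
  trans (mem-fromPred byToℕ a b) (trans (T-injective (forth a b) (back a b)) (sym (mem-fromPred (singleton e) a b)))
  where
  byToℕ : DiagPred n
  byToℕ a b = (toℕ a ℕ.≡ᵇ l) ∧ (toℕ b ℕ.≡ᵇ h)
  forth : ∀ a b → T (byToℕ a b) → T (singleton e a b)
  forth a b t with Equivalence.to (T-∧ {toℕ a ℕ.≡ᵇ l}) t
  ... | a≡ , b≡ with toℕ-injective {i = a} {lo e} (trans (≡ᵇ⇒≡ _ _ a≡) (sym lo≡l))
                   | toℕ-injective {i = b} {hi e} (trans (≡ᵇ⇒≡ _ _ b≡) (sym hi≡h))
  ... | refl | refl = insert-new {f = ∅ᵖ} {lo e} {hi e}
  back : ∀ a b → T (singleton e a b) → T (byToℕ a b)
  back a b t with insert-cases {f = ∅ᵖ} {lo e} {hi e} {a} {b} t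
  ... | inj₂ (refl , refl) = Equivalence.from T-∧ (≡⇒≡ᵇ _ _ lo≡l , ≡⇒≡ᵇ _ _ hi≡h)

-- The facet F_k is given by the diagonal {k - 1 , k + 1}, the ear at k - 1.
facetSet≡ear : ∀ {n} (2≤n : 2 ≤ n) k → facetSet n k ≡ ⟦ ear 2≤n (vertex (k + (2 + n))) ⟧
facetSet≡ear {n} 2≤n k = ⟦⟧-by-toℕ (ear 2≤n x) (trans (proj₁ ends) (cong₂ _⊓_ (toℕ-vertex (k + (2 + n))) toℕ-next²))
                                                (trans (proj₂ ends) (cong₂ _⊔_ (toℕ-vertex (k + (2 + n))) toℕ-next²))
  where
  x : Vtx n
  x = vertex (k + (2 + n))
  ends : toℕ (lo (ear 2≤n x)) ≡ toℕ x ⊓ toℕ (next (next x)) × toℕ (hi (ear 2≤n x)) ≡ toℕ x ⊔ toℕ (next (next x))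
  ends = toℕ-chord x (next (next x)) (ear-nonAdjacent 2≤n x)
  toℕ-next² : toℕ (next (next x)) ≡ (k + 1) % (3 + n)
  toℕ-next² = begin
    toℕ (next (next x))                 ≡⟨ cong toℕ (nextⁱ≡+ᵥ 2 x) ⟩
    toℕ (x +ᵥ 2)                        ≡⟨ cong toℕ (vertex-+ᵥ (k + (2 + n)) 2) ⟩
    toℕ (vertex {n} (k + (2 + n) + 2))  ≡⟨ cong (λ i → toℕ (vertex {n} i)) (ℕ.+-assoc k (2 + n) 2) ⟩
    toℕ (vertex {n} (k + (2 + n + 2)))  ≡⟨ cong (λ i → toℕ (vertex {n} (k + i))) (ℕ.+-comm (2 + n) 2) ⟩
    toℕ (vertex {n} (k + (1 + (3 + n)))) ≡⟨ cong (λ i → toℕ (vertex {n} i)) (sym (ℕ.+-assoc k 1 (3 + n))) ⟩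
    toℕ (vertex {n} (k + 1 + (3 + n)))  ≡⟨ cong toℕ (vertex-+m (k + 1)) ⟩
    toℕ (vertex {n} (k + 1))            ≡⟨ toℕ-vertex (k + 1) ⟩
    (k + 1) % (3 + n)                   ∎
    where open ≡-Reasoning

lemma6 : (n : ℕ) → 2 ≤ n → (γ : Automorphism n) → (j : Vtx n)
       → FixesFacet γ (toℕ j) → FixesFacet γ (suc (toℕ j))
       → ∀ (F : Face n) → to γ F ≡ F
lemma6 n 2≤n γ j fixes-Fj fixes-Fj+1 = fixes-faces γ λ d → trans (γ-facetOf γ d) (cong facetOf (σ-identity d))
  where
  fixed-ear : ∀ k → FixesFacet γ k → σ γ (ear 2≤n (vertex (k + (2 + n)))) ≡ ear 2≤n (vertex (k + (2 + n)))
  fixed-ear k fixes-Fk = facetOf-injective (trans (sym (γ-facetOf γ e)) (begin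
    to γ (facetOf e)              ≡⟨ cong (to γ) (facetOf-face e) ⟩
    to γ (face ⟦ e ⟧ (⟦⟧-valid e)) ≡⟨ subst (λ S → ∀ p → to γ (face S p) ≡ face S p) (facetSet≡ear 2≤n k) fixes-Fk (⟦⟧-valid e) ⟩
    face ⟦ e ⟧ (⟦⟧-valid e)        ≡⟨ facetOf-face e ⟨
    facetOf e                     ∎))
    where
    open ≡-Reasoning
    e : Diagonal n
    e = ear 2≤n (vertex (k + (2 + n)))
  v : Vtx n
  v = vertex (toℕ j + (2 + n))
  σ-identity : ∀ d → σ γ d ≡ d
  σ-identity = fixed-all 2≤n (σ γ) (σ-surjective γ) (σ-crossing γ) (σ-noncrossing γ) v
    (fixed-ear (toℕ j) fixes-Fj)
    (subst (λ u → σ γ (ear 2≤n u) ≡ ear 2≤n u) (sym (next-vertex (toℕ j + (2 + n)))) (fixed-ear (suc (toℕ j)) fixes-Fj+1))
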